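{- For $n\ge 4$, \[ \sum_{w\in D_n} q^{\operatorname{sor}_D(w)} = \prod_{i=1}^{n-1}(1+q^i)[i+1]_q = [n]_q\cdot\prod_{i=1}^{n-1}[2i]_q, \] where $[k]_q = 1+q+\cdots+q^{k-1}$.
   Context: $D_n$ is the subgroup of signed permutations of $\{\pm1,\ldots,\pm n\}$ (bijections with $w(-i)=-w(i)$, product $(uv)(x)=u(v(x))$) with an even number of negative values among $w(1),\ldots,w(n)$; $\bar i=-i$. For $i\ne\pm j$, $t_{ij}$ exchanges $i\leftrightarrow j$ and $-i\leftrightarrow -j$, fixing all else; for $2\le j\le n$, $t_{\bar j j}$ denotes the element negating $1$ and $j$ (i.e. $1\mapsto-1$, $j\mapsto -j$) and fixing all else. Every $w\in D_n$ has a unique factorization $w=t_{i_1j_1}\cdots t_{i_kj_k}$ with $1<j_1<\cdots<j_k$ and each $i_s\in\{ -j_s,\ldots,j_s-1\}\setminus\{0\}$. The type D sorting index is $\operatorname{sor}_D(w)=\sum_{s=1}^k\bigl(j_s-i_s-2\chi(i_s<0)\bigr)$, where $\chi(i_s<0)$ is $1$ if $i_s<0$ and $0$ otherwise. -}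

module Defs where

open import Data.Nat as ℕ using (ℕ; zero; suc; _+_; _*_; _∸_; _^_)
open import Data.Integer as ℤ using (ℤ; +_; -[1+_]; -_; ∣_∣)
open import Data.List using (List; []; _∷_; _++_; map; concatMap; filterᵇ; upTo)
open import Data.Nat.ListAction using (sum; product)
open import Data.Bool using (Bool; true; false; if_then_else_; _∧_; _∨_; not)
open import Relation.Nullary.Decidable using (⌊_⌋)
open import Data.Product using (_×_; _,_)

range : ℕ → List ℕ
range n = map suc (upTo n)

signedVals : ℕ → List ℤ
signedVals n = map +_ (range n) ++ map (λ k → - (+ k)) (range n)

words : ℕ → ℕ → List (List ℤ)
words n zero = [] ∷ []
words n (suc m) = concatMap (λ x → map (x ∷_) (words n m)) (signedVals n)

-- Signed permutations in window notation [w(1), ..., w(n)]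

elemℕ : ℕ → List ℕ → Bool
elemℕ x [] = false
elemℕ x (y ∷ ys) = ⌊ x ℕ.≟ y ⌋ ∨ elemℕ x ys

distinct : List ℕ → Bool
distinct [] = true
distinct (x ∷ xs) = not (elemℕ x xs) ∧ distinct xs

negCount : List ℤ → ℕ
negCount [] = 0
negCount (+ _ ∷ xs) = negCount xs
negCount (-[1+ _ ] ∷ xs) = suc (negCount xs)

isEven : ℕ → Bool
isEven zero = true
isEven (suc zero) = false
isEven (suc (suc k)) = isEven k

-- a word of length n over {±1..±n} is a signed permutation iff the
-- absolute values are distinct; it lies in D_n iff moreover it has an
-- even number of negative entries
isDn : List ℤ → Bool
isDn w = distinct (map ∣_∣ w) ∧ isEven (negCount w)

Dn : ℕ → List (List ℤ)
Dn n = filterᵇ isDn (words n n)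

-- 1-indexed lookup (0 outside the window; never used there)
nth : List ℤ → ℕ → ℤ
nth _ zero = + 0
nth [] (suc _) = + 0
nth (x ∷ xs) (suc zero) = x
nth (x ∷ xs) (suc (suc k)) = nth xs (suc k)

-- w(x) for x ∈ {±1..±n}, using w(-x) = -w(x)
apply : List ℤ → ℤ → ℤ
apply w (+ k) = nth w k
apply w -[1+ k ] = - nth w (suc k)

infix 4 _==_
_==_ : ℤ → ℤ → Bool
x == y = ⌊ x ℤ.≟ y ⌋

-- the generator t_{ij} as a map on ℤ (j ≥ 2, i ∈ {-j..j-1}∖{0});
-- t_{-j j} negates 1 and j, otherwise t_{ij} swaps i↔j and -i↔-j
t : ℤ → ℕ → ℤ → ℤ
t i j x =
  if i == - (+ j)
  then (if (∣ x ∣ ℕ.≡ᵇ 1) ∨ (∣ x ∣ ℕ.≡ᵇ j) then - x else x)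
  else (if x == i then + j
        else if x == + j then i
        else if x == - i then - (+ j)
        else if x == - (+ j) then - i
        else x)

-- window of the product w · t_{ij}  (product (uv)(x) = u(v(x)))
mulT : ℕ → List ℤ → ℤ → ℕ → List ℤ
mulT n w i j = map (λ k → apply w (t i j (+ k))) (range n)

invFind : List ℤ → ℤ → List ℤ → ℤ
invFind w y [] = + 0
invFind w y (x ∷ xs) = if apply w x == y then x else invFind w y xs

inv : ℕ → List ℤ → ℤ → ℤ
inv n w y = invFind w y (signedVals n)

-- The unique factorization w = t_{i₁j₁} ⋯ t_{i_k j_k}, 1 < j₁ < ⋯ < j_k,
-- returned as the list [(i₁,j₁), …, (i_k,j_k)].  It is computed from the
-- largest j down: the factor with j_k = j (if any) has i = w⁻¹(j), and
-- w = v · t_{i j} with v = w · t_{i j} fixing j; no factor with this j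
-- occurs iff w⁻¹(j) = j.
factorsAux : ℕ → ℕ → List ℤ → List (ℤ × ℕ)
factorsAux n zero w = []
factorsAux n (suc zero) w = []
factorsAux n (suc (suc j)) w =
  if i == + (suc (suc j))
  then factorsAux n (suc j) w
  else factorsAux n (suc j) (mulT n w i (suc (suc j))) ++ ((i , suc (suc j)) ∷ [])
  where
  i : ℤ
  i = inv n w (+ (suc (suc j)))

factorization : ℕ → List ℤ → List (ℤ × ℕ)
factorization n w = factorsAux n n w

-- contribution j - i - 2χ(i<0) of a factor t_{ij}
weight : ℤ × ℕ → ℕ
weight (+ a , j) = j ∸ a
weight (-[1+ a ] , j) = (j + suc a) ∸ 2

sorD : ℕ → List ℤ → ℕ
sorD n w = sum (map weight (factorization n w))

qint : ℕ → ℕ → ℕ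
qint k q = sum (map (q ^_) (upTo k))

sorGF : ℕ → ℕ → ℕ
sorGF n q = sum (map (λ w → q ^ sorD n w) (Dn n))

prod1 : ℕ → ℕ → ℕ
prod1 n q = product (map (λ i → (1 + q ^ i) * qint (suc i) q) (range (n ∸ 1)))

prod2 : ℕ → ℕ → ℕ
prod2 n q = qint n q * product (map (λ i → qint (2 * i) q) (range (n ∸ 1)))

module Submission where

-- Every w ∈ D_n factors uniquely as t_{i₂ 2} ⋯ t_{iₙ n} with i_j ∈ {±1, …, ±j}: the last factor is
-- peeled off as i = w⁻¹(n), after which w · t_{i n} fixes n and again lies in D_n, because right
-- multiplication by t_{ij} only swaps, swaps and negates, or negates two entries of the window and so
-- keeps the number of negative entries even.  The sorting index is additive over the factors, so the
-- generating function is ∏_j Σ_{i ∈ ±[j]} q^{j − i − 2χ(i<0)} = ∏_j (1 + q^{j−1}) [j]_q, and the second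
-- product formula follows from [2i]_q = (1 + q^i) [i]_q.

open import Defs
open import Data.Nat using (ℕ; _≤_)
open import Data.Product using (_×_)
open import Relation.Binary.PropositionalEquality using (_≡_)

open import Data.Bool using (Bool; true; false; T; not; if_then_else_; _∨_)
import Data.Bool.Properties as Bool
open import Data.Empty using (⊥; ⊥-elim)
open import Data.Integer as ℤ using (ℤ; +_; -[1+_]; -_; ∣_∣)
import Data.Integer.Properties as ℤ
open import Data.List using (List; []; _∷_; _++_; [_]; map; concatMap; length; upTo; applyUpTo)
import Data.List.Properties as List
open import Data.List.Membership.Propositional using (_∈_; find; lose)
open import Data.List.Membership.Propositional.Properties
open import Data.List.Membership.Propositional.Properties.WithK using (unique∧set⇒bag)
open import Data.List.Relation.Binary.BagAndSetEquality using (∼bag⇒↭)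
open import Data.List.Relation.Binary.Permutation.Propositional using (_↭_)
import Data.List.Relation.Binary.Permutation.Propositional.Properties as Perm
open import Data.List.Relation.Binary.Subset.Propositional using (_⊆_)
open import Data.List.Relation.Unary.All as All using (All; []; _∷_)
import Data.List.Relation.Unary.All.Properties as All
open import Data.List.Relation.Unary.Any using (here; there)
open import Data.List.Relation.Unary.Unique.Propositional using (Unique; []; _∷_)
import Data.List.Relation.Unary.Unique.Propositional.Properties as Unique
open import Data.Nat as ℕ using (zero; suc; _+_; _*_; _∸_; _^_; _<_; z≤n; s≤s)
import Data.Nat.Properties as ℕ
open import Data.Nat.Divisibility using (_∣_; _∣0; ∣-refl; ∣-reflexive; m∣m*n; ∣m∣n⇒∣m+n; ∣m+n∣m⇒∣n; ∣1⇒≡1)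
open import Data.Nat.ListAction using (sum; product)
open import Data.Nat.ListAction.Properties using (sum-++; sum-↭; product-++)
open import Data.Nat.Solver using (module +-*-Solver)
open import Data.Product using (_,_; proj₁; proj₂; ∃)
open import Data.Sum using (_⊎_; inj₁; inj₂)
open import Function using (_∘_; Equivalence; mk⇔)
open import Relation.Nullary using (¬_; Dec; yes; no; contradiction)
open import Relation.Binary.Definitions using (DecidableEquality)
open import Relation.Binary.PropositionalEquality hiding (_≡_; [_])

module _ {A : Set} where

  ∈-++-drop : ∀ (xs ys : List A) {x z} → z ∈ xs ++ x ∷ ys → z ≢ x → z ∈ xs ++ ys
  ∈-++-drop xs ys z∈ z≢x with ∈-++⁻ xs z∈
  ... | inj₁ p = ∈-++⁺ˡ p
  ... | inj₂ (here refl) = contradiction refl z≢x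
  ... | inj₂ (there p) = ∈-++⁺ʳ xs p

  length-++-∷ : ∀ (xs ys : List A) {x} → length (xs ++ x ∷ ys) ≡ suc (length (xs ++ ys))
  length-++-∷ xs ys {x} = begin
    length (xs ++ x ∷ ys)          ≡⟨ List.length-++ xs ⟩
    length xs + suc (length ys)    ≡⟨ ℕ.+-suc (length xs) _ ⟩
    suc (length xs + length ys)    ≡⟨ cong suc (List.length-++ xs) ⟨
    suc (length (xs ++ ys))        ∎
    where open ≡-Reasoning

  Unique-⊆⇒length≤ : ∀ {xs ys : List A} → Unique xs → xs ⊆ ys → length xs ≤ length ys
  Unique-⊆⇒length≤ {[]} _ _ = z≤n
  Unique-⊆⇒length≤ {x ∷ xs} (x∉xs ∷ u) xs⊆ys with ys₁ , ys₂ , refl ← ∈-∃++ (xs⊆ys (here refl)) =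
    ℕ.≤-trans (s≤s (Unique-⊆⇒length≤ u drop-x)) (ℕ.≤-reflexive (sym (length-++-∷ ys₁ ys₂)))
    where
    drop-x : xs ⊆ ys₁ ++ ys₂
    drop-x z∈ = ∈-++-drop ys₁ ys₂ (xs⊆ys (there z∈)) λ { refl → All.lookup x∉xs z∈ refl }

  Unique-⊆-↭ : ∀ {xs ys : List A} → Unique xs → Unique ys → xs ⊆ ys → ys ⊆ xs → xs ↭ ys
  Unique-⊆-↭ ux uy xs⊆ys ys⊆xs = ∼bag⇒↭ (unique∧set⇒bag ux uy (mk⇔ xs⊆ys ys⊆xs))

  Unique-map⁺-local : ∀ {B : Set} (f : A → B) {xs} →
    (∀ {x y} → x ∈ xs → y ∈ xs → f x ≡ f y → x ≡ y) → Unique xs → Unique (map f xs)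
  Unique-map⁺-local f _ [] = []
  Unique-map⁺-local f {x ∷ xs} inj (x∉xs ∷ u) =
    All.map⁺ (All.tabulate λ {y} y∈ fx≡fy → All.lookup x∉xs y∈ (inj (here refl) (there y∈) fx≡fy))
    ∷ Unique-map⁺-local f (λ x∈ y∈ → inj (there x∈) (there y∈)) u

  Unique-concatMap⁺ : ∀ {B : Set} (f : A → List B) {xs} → Unique xs →
    (∀ {x} → x ∈ xs → Unique (f x)) →
    (∀ {x x′ z} → x ∈ xs → x′ ∈ xs → z ∈ f x → z ∈ f x′ → x ≡ x′) →
    Unique (concatMap f xs)
  Unique-concatMap⁺ f [] _ _ = []
  Unique-concatMap⁺ f {x ∷ xs} (x∉xs ∷ u) uf disj =
    Unique.++⁺ (uf (here refl)) (Unique-concatMap⁺ f u (uf ∘ there) (λ p q → disj (there p) (there q)))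
      λ (z∈fx , z∈rest) → let x′ , x′∈xs , z∈fx′ = find (∈-concatMap⁻ f {xs = xs} z∈rest) in
        All.lookup x∉xs x′∈xs (disj (here refl) (there x′∈xs) z∈fx z∈fx′)

  Unique-map⇒injective : ∀ {B : Set} (f : A → B) {xs} → Unique (map f xs) →
    ∀ {x y} → x ∈ xs → y ∈ xs → f x ≡ f y → x ≡ y
  Unique-map⇒injective f (_ ∷ _) (here refl) (here refl) _ = refl
  Unique-map⇒injective f (fx∉ ∷ _) (here refl) (there y∈) fx≡fy = contradiction fx≡fy (All.lookup fx∉ (∈-map⁺ f y∈))
  Unique-map⇒injective f (fy∉ ∷ _) (there x∈) (here refl) fx≡fy = contradiction (sym fx≡fy) (All.lookup fy∉ (∈-map⁺ f x∈))
  Unique-map⇒injective f (_ ∷ u) (there x∈) (there y∈) fx≡fy = Unique-map⇒injective f u x∈ y∈ fx≡fy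

module _ {A : Set} (_≟_ : DecidableEquality A) where

  open import Data.List.Membership.DecPropositional _≟_ using (_∈?_)

  ⊆-pigeonhole : ∀ {xs ys : List A} → Unique xs → xs ⊆ ys → length ys ≤ length xs → ys ⊆ xs
  ⊆-pigeonhole {xs} ux xs⊆ys len {y} y∈ys with y ∈? xs
  ... | yes y∈xs = y∈xs
  ... | no y∉xs with ys₁ , ys₂ , refl ← ∈-∃++ y∈ys =
    ⊥-elim (ℕ.<-irrefl refl (ℕ.<-≤-trans (ℕ.≤-<-trans shorter (ℕ.≤-reflexive (sym (length-++-∷ ys₁ ys₂)))) len))
    where
    shorter : length xs ≤ length (ys₁ ++ ys₂)
    shorter = Unique-⊆⇒length≤ ux λ z∈ → ∈-++-drop ys₁ ys₂ (xs⊆ys z∈) λ { refl → y∉xs z∈ }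

module _ {A : Set} where

  sum-map-cong : ∀ (xs : List A) {f g : A → ℕ} → (∀ {x} → x ∈ xs → f x ≡ g x) →
    sum (map f xs) ≡ sum (map g xs)
  sum-map-cong xs f≡g = cong sum (List.map-cong-local (All.tabulate f≡g))

  sum-map-*ˡ : ∀ (c : ℕ) (f : A → ℕ) (xs : List A) → sum (map (λ x → c * f x) xs) ≡ c * sum (map f xs)
  sum-map-*ˡ c f [] = sym (ℕ.*-zeroʳ c)
  sum-map-*ˡ c f (x ∷ xs) = trans (cong (λ z → c * f x + z) (sum-map-*ˡ c f xs)) (sym (ℕ.*-distribˡ-+ c (f x) _))

  sum-concatMap : ∀ {B : Set} (g : B → ℕ) (f : A → List B) (xs : List A) →
    sum (map g (concatMap f xs)) ≡ sum (map (λ x → sum (map g (f x))) xs)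
  sum-concatMap g f [] = refl
  sum-concatMap g f (x ∷ xs) = begin
    sum (map g (f x ++ concatMap f xs))              ≡⟨ cong sum (List.map-++ g (f x) _) ⟩
    sum (map g (f x) ++ map g (concatMap f xs))      ≡⟨ sum-++ (map g (f x)) _ ⟩
    sum (map g (f x)) + sum (map g (concatMap f xs)) ≡⟨ cong (λ z → sum (map g (f x)) + z) (sum-concatMap g f xs) ⟩
    sum (map g (f x)) + sum (map (λ y → sum (map g (f y))) xs) ∎
    where open ≡-Reasoning

  sum-map-*ʳ : ∀ (c : ℕ) (f : A → ℕ) (xs : List A) → sum (map (λ x → f x * c) xs) ≡ sum (map f xs) * c
  sum-map-*ʳ c f xs = begin
    sum (map (λ x → f x * c) xs) ≡⟨ sum-map-cong xs (λ {x} _ → ℕ.*-comm (f x) c) ⟩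
    sum (map (λ x → c * f x) xs) ≡⟨ sum-map-*ˡ c f xs ⟩
    c * sum (map f xs)           ≡⟨ ℕ.*-comm c _ ⟩
    sum (map f xs) * c           ∎
    where open ≡-Reasoning

  sum-map-update : ∀ {xs : List A} {f g : A → ℕ} {a} → Unique xs → a ∈ xs →
    (∀ {x} → x ∈ xs → x ≢ a → g x ≡ f x) → sum (map g xs) + f a ≡ sum (map f xs) + g a
  sum-map-update {x ∷ xs} {f} {g} (x∉xs ∷ u) (here refl) g≡f = begin
    (g x + sum (map g xs)) + f x ≡⟨ cong (λ s → (g x + s) + f x) (sum-map-cong xs λ y∈ → g≡f (there y∈) (x∉ y∈)) ⟩
    (g x + sum (map f xs)) + f x ≡⟨ ℕ.+-comm (g x + _) (f x) ⟩
    f x + (g x + sum (map f xs)) ≡⟨ cong (λ z → f x + z) (ℕ.+-comm (g x) _) ⟩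
    f x + (sum (map f xs) + g x) ≡⟨ ℕ.+-assoc (f x) _ (g x) ⟨
    (f x + sum (map f xs)) + g x ∎
    where
    open ≡-Reasoning
    x∉ : ∀ {y} → y ∈ xs → y ≢ x
    x∉ y∈ refl = All.lookup x∉xs y∈ refl
  sum-map-update {x ∷ xs} {f} {g} {a} (x∉xs ∷ u) (there a∈) g≡f = begin
    (g x + sum (map g xs)) + f a ≡⟨ ℕ.+-assoc (g x) _ (f a) ⟩
    g x + (sum (map g xs) + f a) ≡⟨ cong₂ _+_ (g≡f (here refl) x≢a) (sum-map-update u a∈ (g≡f ∘ there)) ⟩
    f x + (sum (map f xs) + g a) ≡⟨ ℕ.+-assoc (f x) _ (g a) ⟨
    (f x + sum (map f xs)) + g a ∎
    where
    open ≡-Reasoning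
    x≢a : x ≢ a
    x≢a refl = All.lookup x∉xs a∈ refl

module _ {A : Set} (_≟_ : DecidableEquality A) where

  sum-map-update₂ : ∀ {xs : List A} {f g : A → ℕ} {a b} → Unique xs → a ∈ xs → b ∈ xs → a ≢ b →
    (∀ {x} → x ∈ xs → x ≢ a → x ≢ b → g x ≡ f x) →
    sum (map g xs) + (f a + f b) ≡ sum (map f xs) + (g a + g b)
  sum-map-update₂ {xs} {f} {g} {a} {b} u a∈ b∈ a≢b g≡f = begin
    sum (map g xs) + (f a + f b)   ≡⟨ cong (λ z → sum (map g xs) + z) (ℕ.+-comm (f a) (f b)) ⟩
    sum (map g xs) + (f b + f a)   ≡⟨ ℕ.+-assoc (sum (map g xs)) _ _ ⟨
    (sum (map g xs) + f b) + f a   ≡⟨ cong (λ z → (sum (map g xs) + z) + f a) (sym (h-other (a≢b ∘ sym))) ⟩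
    (sum (map g xs) + h b) + f a   ≡⟨ cong (_+ f a) (sum-map-update u b∈ g≡h) ⟩
    (sum (map h xs) + g b) + f a   ≡⟨ ℕ.+-assoc (sum (map h xs)) _ _ ⟩
    sum (map h xs) + (g b + f a)   ≡⟨ cong (λ z → sum (map h xs) + z) (ℕ.+-comm (g b) (f a)) ⟩
    sum (map h xs) + (f a + g b)   ≡⟨ ℕ.+-assoc (sum (map h xs)) _ _ ⟨
    (sum (map h xs) + f a) + g b   ≡⟨ cong (_+ g b) (sum-map-update u a∈ λ _ x≢a → h-other x≢a) ⟩
    (sum (map f xs) + h a) + g b   ≡⟨ cong (λ z → (sum (map f xs) + z) + g b) h-a ⟩
    (sum (map f xs) + g a) + g b   ≡⟨ ℕ.+-assoc (sum (map f xs)) _ _ ⟩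
    sum (map f xs) + (g a + g b)   ∎
    where
    open ≡-Reasoning
    h : A → ℕ
    h x with x ≟ a
    ... | yes _ = g x
    ... | no _ = f x
    h-a : h a ≡ g a
    h-a with a ≟ a
    ... | yes _ = refl
    ... | no a≢a = contradiction refl a≢a
    h-other : ∀ {x} → x ≢ a → h x ≡ f x
    h-other {x} x≢a with x ≟ a
    ... | yes x≡a = contradiction x≡a x≢a
    ... | no _ = refl
    g≡h : ∀ {x} → x ∈ xs → x ≢ b → g x ≡ h x
    g≡h {x} x∈ x≢b with x ≟ a
    ... | yes _ = refl
    ... | no x≢a = g≡f x∈ x≢a x≢b

-- The signed values ±1, …, ±j

infix 4 _∈±_
data _∈±_ : ℤ → ℕ → Set where
  +∈± : ∀ {b j} → b < j → + suc b ∈± j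
  -∈± : ∀ {b j} → b < j → -[1+ b ] ∈± j

module _ {j : ℕ} where

  ∈±-neg : ∀ {x} → x ∈± j → - x ∈± j
  ∈±-neg (+∈± b<j) = -∈± b<j
  ∈±-neg (-∈± b<j) = +∈± b<j

  ∈±-mono : ∀ {k x} → j ≤ k → x ∈± j → x ∈± k
  ∈±-mono j≤k (+∈± b<j) = +∈± (ℕ.<-≤-trans b<j j≤k)
  ∈±-mono j≤k (-∈± b<j) = -∈± (ℕ.<-≤-trans b<j j≤k)

  ∈±⇒≢0 : ∀ {x} → x ∈± j → x ≢ + 0
  ∈±⇒≢0 (+∈± _) ()
  ∈±⇒≢0 (-∈± _) ()

  ∈±⇒1≤∣∣ : ∀ {x} → x ∈± j → 1 ≤ ∣ x ∣
  ∈±⇒1≤∣∣ (+∈± _) = s≤s z≤n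
  ∈±⇒1≤∣∣ (-∈± _) = s≤s z≤n

  ∈±⇒∣∣≤ : ∀ {x} → x ∈± j → ∣ x ∣ ≤ j
  ∈±⇒∣∣≤ (+∈± b<j) = b<j
  ∈±⇒∣∣≤ (-∈± b<j) = b<j

  ∈±-∣∣ : ∀ x → 1 ≤ ∣ x ∣ → ∣ x ∣ ≤ j → x ∈± j
  ∈±-∣∣ (+ suc b) _ b<j = +∈± b<j
  ∈±-∣∣ -[1+ b ] _ b<j = -∈± b<j

  ∈±-+ : ∀ {k} → 1 ≤ k → k ≤ j → + k ∈± j
  ∈±-+ {suc k} _ k<j = +∈± k<j

∣∣≡∣∣⇒≡⊎≡- : ∀ {x y : ℤ} → ∣ x ∣ ≡ ∣ y ∣ → x ≡ y ⊎ x ≡ - y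
∣∣≡∣∣⇒≡⊎≡- {+ _} {+ _} refl = inj₁ refl
∣∣≡∣∣⇒≡⊎≡- {+ suc _} { -[1+ _ ]} refl = inj₂ refl
∣∣≡∣∣⇒≡⊎≡- { -[1+ _ ]} {+ suc _} refl = inj₂ refl
∣∣≡∣∣⇒≡⊎≡- { -[1+ _ ]} { -[1+ _ ]} refl = inj₁ refl

≡-neg⇒≡0 : ∀ {x} → x ≡ - x → x ≡ + 0
≡-neg⇒≡0 {+ zero} _ = refl

+≢-+ : ∀ k {m} → 1 ≤ m → + k ≢ - (+ m)
+≢-+ k {suc m} _ ()

∈-range⁺ : ∀ {n k} → 1 ≤ k → k ≤ n → k ∈ range n
∈-range⁺ {k = suc k} _ k<n = ∈-map⁺ suc (∈-upTo⁺ k<n)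

∈-range⁻ : ∀ {n k} → k ∈ range n → 1 ≤ k × k ≤ n
∈-range⁻ k∈ with _ , b∈ , refl ← ∈-map⁻ suc k∈ = s≤s z≤n , ∈-upTo⁻ b∈

Unique-range : ∀ n → Unique (range n)
Unique-range n = Unique.map⁺ ℕ.suc-injective (Unique.upTo⁺ n)

∈-signedVals⁺ : ∀ {n x} → x ∈± n → x ∈ signedVals n
∈-signedVals⁺ {n} (+∈± b<n) = ∈-++⁺ˡ (∈-map⁺ +_ (∈-range⁺ (s≤s z≤n) b<n))
∈-signedVals⁺ {n} (-∈± b<n) = ∈-++⁺ʳ (map +_ (range n)) (∈-map⁺ (λ k → - (+ k)) (∈-range⁺ (s≤s z≤n) b<n))

∈-signedVals⁻ : ∀ {n x} → x ∈ signedVals n → x ∈± n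
∈-signedVals⁻ {n} x∈ with ∈-++⁻ (map +_ (range n)) x∈
... | inj₁ x∈⁺ with k , k∈ , refl ← ∈-map⁻ +_ x∈⁺ = let 1≤k , k≤n = ∈-range⁻ k∈ in ∈±-+ 1≤k k≤n
... | inj₂ x∈⁻ with k , k∈ , refl ← ∈-map⁻ (λ k → - (+ k)) x∈⁻ = let 1≤k , k≤n = ∈-range⁻ k∈ in ∈±-neg (∈±-+ 1≤k k≤n)

Unique-signedVals : ∀ n → Unique (signedVals n)
Unique-signedVals n = Unique.++⁺ (Unique.map⁺ ℤ.+-injective (Unique-range n))
  (Unique.map⁺ (ℤ.+-injective ∘ ℤ.neg-injective) (Unique-range n))
  λ (x∈⁺ , x∈⁻) → let k , _ , x≡k = ∈-map⁻ +_ x∈⁺ ; m , m∈ , x≡-m = ∈-map⁻ (λ k → - (+ k)) x∈⁻ in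
    +≢-+ k (proj₁ (∈-range⁻ m∈)) (trans (sym x≡k) x≡-m)

-- The generators t_{ij}

if-true : ∀ {A : Set} {b} {x y : A} → b ≡ true → (if b then x else y) ≡ x
if-true refl = refl

if-false : ∀ {A : Set} {b} {x y : A} → b ≡ false → (if b then x else y) ≡ y
if-false refl = refl

==-true : ∀ {x y} → x ≡ y → (x == y) ≡ true
==-true {x} refl with x ℤ.≟ x
... | yes _ = refl
... | no x≢x = contradiction refl x≢x

==-false : ∀ {x y} → x ≢ y → (x == y) ≡ false
==-false {x} {y} x≢y with x ℤ.≟ y
... | yes x≡y = contradiction x≡y x≢y
... | no _ = refl

≡ᵇ-false : ∀ {m k} → m ≢ k → (m ℕ.≡ᵇ k) ≡ false
≡ᵇ-false {m} {k} m≢k with m ℕ.≡ᵇ k in eq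
... | true = contradiction (ℕ.≡ᵇ⇒≡ m k (subst T (sym eq) _)) m≢k
... | false = refl

≡ᵇ-refl : ∀ m → (m ℕ.≡ᵇ m) ≡ true
≡ᵇ-refl m = Equivalence.to Bool.T-≡ (ℕ.≡⇒≡ᵇ m m refl)

hits1or : ℕ → ℤ → Bool
hits1or j x = (∣ x ∣ ℕ.≡ᵇ 1) ∨ (∣ x ∣ ℕ.≡ᵇ j)

hits1or-neg : ∀ j x → hits1or j (- x) ≡ hits1or j x
hits1or-neg j x = cong (λ m → (m ℕ.≡ᵇ 1) ∨ (m ℕ.≡ᵇ j)) (ℤ.∣-i∣≡∣i∣ x)

hits1or-at-j : ∀ j x → ∣ x ∣ ≡ j → hits1or j x ≡ true
hits1or-at-j j x refl = trans (cong ((∣ x ∣ ℕ.≡ᵇ 1) ∨_) (≡ᵇ-refl ∣ x ∣)) (Bool.∨-zeroʳ _)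

hits1or-at-1 : ∀ j x → ∣ x ∣ ≡ 1 → hits1or j x ≡ true
hits1or-at-1 j x x≡1 rewrite x≡1 = refl

hits1or-miss : ∀ j x → ∣ x ∣ ≢ 1 → ∣ x ∣ ≢ j → hits1or j x ≡ false
hits1or-miss j x x≢1 x≢j rewrite ≡ᵇ-false x≢1 | ≡ᵇ-false x≢j = refl

-- The two branches of [t], kept opaque so that goals mentioning them do not unfold into nested
-- conditionals; [t-swap] and [t-negate1or] below identify [t] with them.
opaque
  swap : ℤ → ℤ → ℤ → ℤ
  swap p q x = if x == p then q else if x == q then p else if x == - p then - q else if x == - q then - p else x

  negate1or : ℕ → ℤ → ℤ
  negate1or j x = if hits1or j x then - x else x

opaque
  unfolding swap negate1or

  t-swap : ∀ {i j x} → i ≢ - (+ j) → t i j x ≡ swap i (+ j) x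
  t-swap i≢-j = if-false (==-false i≢-j)

  t-negate1or : ∀ {i j x} → i ≡ - (+ j) → t i j x ≡ negate1or j x
  t-negate1or i≡-j = if-true (==-true i≡-j)

  swap-x≡p : ∀ {p q x} → x ≡ p → swap p q x ≡ q
  swap-x≡p x≡p = if-true (==-true x≡p)

  swap-x≡q : ∀ {p q x} → x ≢ p → x ≡ q → swap p q x ≡ p
  swap-x≡q x≢p x≡q = trans (if-false (==-false x≢p)) (if-true (==-true x≡q))

  swap-x≡-p : ∀ {p q x} → x ≢ p → x ≢ q → x ≡ - p → swap p q x ≡ - q
  swap-x≡-p x≢p x≢q x≡-p = trans (if-false (==-false x≢p)) (trans (if-false (==-false x≢q)) (if-true (==-true x≡-p)))

  swap-x≡-q : ∀ {p q x} → x ≢ p → x ≢ q → x ≢ - p → x ≡ - q → swap p q x ≡ - p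
  swap-x≡-q x≢p x≢q x≢-p x≡-q =
    trans (if-false (==-false x≢p)) (trans (if-false (==-false x≢q)) (trans (if-false (==-false x≢-p)) (if-true (==-true x≡-q))))

  swap-fixes : ∀ {p q x} → x ≢ p → x ≢ q → x ≢ - p → x ≢ - q → swap p q x ≡ x
  swap-fixes x≢p x≢q x≢-p x≢-q =
    trans (if-false (==-false x≢p)) (trans (if-false (==-false x≢q)) (trans (if-false (==-false x≢-p)) (if-false (==-false x≢-q))))

  negate1or-hit : ∀ {j x} → hits1or j x ≡ true → negate1or j x ≡ - x
  negate1or-hit = if-true

  negate1or-miss : ∀ {j x} → hits1or j x ≡ false → negate1or j x ≡ x
  negate1or-miss = if-false

negate1or-involutive : ∀ j x → negate1or j (negate1or j x) ≡ x
negate1or-involutive j x with hits1or j x in hit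
... | true = trans (cong (negate1or j) (negate1or-hit hit))
                   (trans (negate1or-hit (trans (hits1or-neg j x) hit)) (ℤ.neg-involutive x))
... | false = trans (cong (negate1or j) (negate1or-miss hit)) (negate1or-miss hit)

negate1or-odd : ∀ j x → negate1or j (- x) ≡ - negate1or j x
negate1or-odd j x with hits1or j x in hit
... | true = trans (negate1or-hit (trans (hits1or-neg j x) hit)) (cong -_ (sym (negate1or-hit hit)))
... | false = trans (negate1or-miss (trans (hits1or-neg j x) hit)) (cong -_ (sym (negate1or-miss hit)))

swap-self : ∀ p x → swap p p x ≡ x
swap-self p x with x ℤ.≟ p | x ℤ.≟ - p
... | yes x≡p | _ = trans (swap-x≡p x≡p) (sym x≡p)
... | no x≢p | yes x≡-p = trans (swap-x≡-p x≢p x≢p x≡-p) (sym x≡-p)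
... | no x≢p | no x≢-p = swap-fixes x≢p x≢p x≢-p x≢-p

swap-cases : ∀ p q x → swap p q x ≡ q ⊎ swap p q x ≡ p ⊎ swap p q x ≡ - q ⊎ swap p q x ≡ - p ⊎ swap p q x ≡ x
swap-cases p q x with x ℤ.≟ p | x ℤ.≟ q | x ℤ.≟ - p | x ℤ.≟ - q
... | yes x≡p | _ | _ | _ = inj₁ (swap-x≡p x≡p)
... | no x≢p | yes x≡q | _ | _ = inj₂ (inj₁ (swap-x≡q x≢p x≡q))
... | no x≢p | no x≢q | yes x≡-p | _ = inj₂ (inj₂ (inj₁ (swap-x≡-p x≢p x≢q x≡-p)))
... | no x≢p | no x≢q | no x≢-p | yes x≡-q = inj₂ (inj₂ (inj₂ (inj₁ (swap-x≡-q x≢p x≢q x≢-p x≡-q))))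
... | no x≢p | no x≢q | no x≢-p | no x≢-q = inj₂ (inj₂ (inj₂ (inj₂ (swap-fixes x≢p x≢q x≢-p x≢-q))))

neg-≢ : ∀ {x y} → x ≢ y → - x ≢ - y
neg-≢ x≢y -x≡-y = x≢y (ℤ.neg-injective -x≡-y)

≢-neg : ∀ {x y} → x ≢ - y → - x ≢ y
≢-neg {x} x≢-y -x≡y = x≢-y (trans (sym (ℤ.neg-involutive x)) (cong -_ -x≡y))

module SwapLaws {p q : ℤ} (p≢0 : p ≢ + 0) (q≢0 : q ≢ + 0) (p≢-q : p ≢ - q) where

  private
    -p≢p : - p ≢ p
    -p≢p -p≡p = p≢0 (≡-neg⇒≡0 (sym -p≡p))

    -q≢q : - q ≢ q
    -q≢q -q≡q = q≢0 (≡-neg⇒≡0 (sym -q≡q))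

    -p≢q : - p ≢ q
    -p≢q = ≢-neg p≢-q

    -q≢p : - q ≢ p
    -q≢p -q≡p = p≢-q (sym -q≡p)

  swap-at-p : swap p q p ≡ q
  swap-at-p = swap-x≡p refl

  swap-at-q : swap p q q ≡ p
  swap-at-q with q ℤ.≟ p
  ... | yes q≡p = trans (swap-x≡p q≡p) q≡p
  ... | no q≢p = swap-x≡q q≢p refl

  swap-at--p : swap p q (- p) ≡ - q
  swap-at--p = swap-x≡-p -p≢p -p≢q refl

  swap-at--q : swap p q (- q) ≡ - p
  swap-at--q with - q ℤ.≟ - p
  ... | yes -q≡-p = trans (swap-x≡-p -q≢p -q≢q -q≡-p) -q≡-p
  ... | no -q≢-p = swap-x≡-q -q≢p -q≢q -q≢-p refl

  swap-involutive : ∀ x → swap p q (swap p q x) ≡ x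
  swap-involutive x with x ℤ.≟ p | x ℤ.≟ q | x ℤ.≟ - p | x ℤ.≟ - q
  ... | yes refl | _ | _ | _ = trans (cong (swap p q) swap-at-p) swap-at-q
  ... | no x≢p | yes refl | _ | _ = trans (cong (swap p q) (swap-x≡q x≢p refl)) swap-at-p
  ... | no x≢p | no x≢q | yes refl | _ = trans (cong (swap p q) (swap-x≡-p x≢p x≢q refl)) swap-at--q
  ... | no x≢p | no x≢q | no x≢-p | yes refl = trans (cong (swap p q) (swap-x≡-q x≢p x≢q x≢-p refl)) swap-at--p
  ... | no x≢p | no x≢q | no x≢-p | no x≢-q =
    trans (cong (swap p q) (swap-fixes x≢p x≢q x≢-p x≢-q)) (swap-fixes x≢p x≢q x≢-p x≢-q)

  swap-odd : ∀ x → swap p q (- x) ≡ - swap p q x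
  swap-odd x with x ℤ.≟ p | x ℤ.≟ q | x ℤ.≟ - p | x ℤ.≟ - q
  ... | yes refl | _ | _ | _ = trans swap-at--p (cong -_ (sym swap-at-p))
  ... | no x≢p | yes refl | _ | _ = trans swap-at--q (cong -_ (sym (swap-x≡q x≢p refl)))
  ... | no x≢p | no x≢q | yes refl | _ =
    trans (cong (swap p q) (ℤ.neg-involutive p)) (trans swap-at-p (trans (sym (ℤ.neg-involutive q)) (cong -_ (sym swap-at--p))))
  ... | no x≢p | no x≢q | no x≢-p | yes refl =
    trans (cong (swap p q) (ℤ.neg-involutive q)) (trans swap-at-q (trans (sym (ℤ.neg-involutive p)) (cong -_ (sym (swap-x≡-q x≢p x≢q x≢-p refl)))))
  ... | no x≢p | no x≢q | no x≢-p | no x≢-q =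
    trans (swap-fixes (≢-neg x≢-p) (≢-neg x≢-q) (neg-≢ x≢p) (neg-≢ x≢q)) (cong -_ (sym (swap-fixes x≢p x≢q x≢-p x≢-q)))

∣∣≢⇒≢ : ∀ {x y : ℤ} → ∣ x ∣ ≢ ∣ y ∣ → x ≢ y
∣∣≢⇒≢ ∣x∣≢∣y∣ x≡y = ∣x∣≢∣y∣ (cong ∣_∣ x≡y)

∣∣≢⇒≢- : ∀ {x y : ℤ} → ∣ x ∣ ≢ ∣ y ∣ → x ≢ - y
∣∣≢⇒≢- {y = y} ∣x∣≢∣y∣ x≡-y = ∣x∣≢∣y∣ (trans (cong ∣_∣ x≡-y) (ℤ.∣-i∣≡∣i∣ y))

t-self : ∀ j x → 1 ≤ j → t (+ j) j x ≡ x
t-self j x 1≤j = trans (t-swap (+≢-+ j 1≤j)) (swap-self (+ j) x)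

Moved : ℤ → ℤ → ℤ → ℤ → Set
Moved x y x′ y′ = (x′ ≡ y × y′ ≡ x) ⊎ (x′ ≡ - y × y′ ≡ - x) ⊎ (x′ ≡ - x × y′ ≡ - y)

Moved-odd : ∀ (f : ℤ → ℤ) → (∀ z → f (- z) ≡ - f z) →
  ∀ {x y x′ y′} → Moved x y x′ y′ → Moved (f x) (f y) (f x′) (f y′)
Moved-odd f f-odd (inj₁ (refl , refl)) = inj₁ (refl , refl)
Moved-odd f f-odd (inj₂ (inj₁ (refl , refl))) = inj₂ (inj₁ (f-odd _ , f-odd _))
Moved-odd f f-odd (inj₂ (inj₂ (refl , refl))) = inj₂ (inj₂ (f-odd _ , f-odd _))

record MovesTwo (τ : ℤ → ℤ) (j : ℕ) : Set where
  field
    a : ℕ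
    1≤a : 1 ≤ a
    a<j : a < j
    moves : Moved (+ a) (+ j) (τ (+ a)) (τ (+ j))
    fixes : ∀ k → 1 ≤ k → k ≢ a → k ≢ j → τ (+ k) ≡ + k

module Generator {i : ℤ} {j : ℕ} (1≤j : 1 ≤ j) (i∈±j : i ∈± j) where

  private
    +j≢0 : + j ≢ + 0
    +j≢0 +j≡0 = ℕ.<-irrefl (sym (ℤ.+-injective +j≡0)) 1≤j

    module Swap (i≢-j : i ≢ - (+ j)) = SwapLaws (∈±⇒≢0 i∈±j) +j≢0 i≢-j

    by-kind : ∀ {A : Set} → (i ≡ - (+ j) → A) → (i ≢ - (+ j) → A) → A
    by-kind negating swapping with i ℤ.≟ - (+ j)
    ... | yes i≡-j = negating i≡-j
    ... | no i≢-j = swapping i≢-j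

  t-involutive : ∀ x → t i j (t i j x) ≡ x
  t-involutive x = by-kind
    (λ i≡-j → trans (t-negate1or i≡-j) (trans (cong (negate1or j) (t-negate1or i≡-j)) (negate1or-involutive j x)))
    (λ i≢-j → trans (t-swap i≢-j) (trans (cong (swap i (+ j)) (t-swap i≢-j)) (Swap.swap-involutive i≢-j x)))

  t-odd : ∀ x → t i j (- x) ≡ - t i j x
  t-odd x = by-kind
    (λ i≡-j → trans (t-negate1or i≡-j) (trans (negate1or-odd j x) (cong -_ (sym (t-negate1or i≡-j)))))
    (λ i≢-j → trans (t-swap i≢-j) (trans (Swap.swap-odd i≢-j x) (cong -_ (sym (t-swap i≢-j)))))

  t-∈± : ∀ {n x} → j ≤ n → x ∈± n → t i j x ∈± n
  t-∈± {n} {x} j≤n x∈± = by-kind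
    (λ i≡-j → subst (_∈± n) (sym (t-negate1or i≡-j)) negate1or-∈±)
    (λ i≢-j → subst (_∈± n) (sym (t-swap i≢-j)) (swap-∈± (swap-cases i (+ j) x)))
    where
    negate1or-∈± : negate1or j x ∈± n
    negate1or-∈± with hits1or j x in hit
    ... | true = subst (_∈± n) (sym (negate1or-hit hit)) (∈±-neg x∈±)
    ... | false = subst (_∈± n) (sym (negate1or-miss hit)) x∈±
    +j∈± : + j ∈± n
    +j∈± = ∈±-+ 1≤j j≤n
    i∈±n : i ∈± n
    i∈±n = ∈±-mono j≤n i∈±j
    swap-∈± : ∀ {y} → y ≡ + j ⊎ y ≡ i ⊎ y ≡ - (+ j) ⊎ y ≡ - i ⊎ y ≡ x → y ∈± n
    swap-∈± (inj₁ refl) = +j∈±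
    swap-∈± (inj₂ (inj₁ refl)) = i∈±n
    swap-∈± (inj₂ (inj₂ (inj₁ refl))) = ∈±-neg +j∈±
    swap-∈± (inj₂ (inj₂ (inj₂ (inj₁ refl)))) = ∈±-neg i∈±n
    swap-∈± (inj₂ (inj₂ (inj₂ (inj₂ refl)))) = x∈±

  t-at-i : t i j i ≡ + j
  t-at-i = by-kind
    (λ i≡-j → trans (t-negate1or i≡-j)
      (trans (negate1or-hit (hits1or-at-j j i (trans (cong ∣_∣ i≡-j) (ℤ.∣-i∣≡∣i∣ (+ j)))))
             (trans (cong -_ i≡-j) (ℤ.neg-involutive (+ j)))))
    (λ i≢-j → trans (t-swap i≢-j) (Swap.swap-at-p i≢-j))

  t-at-j : t i j (+ j) ≡ i
  t-at-j = by-kind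
    (λ i≡-j → trans (t-negate1or i≡-j) (trans (negate1or-hit (hits1or-at-j j (+ j) refl)) (sym i≡-j)))
    (λ i≢-j → trans (t-swap i≢-j) (Swap.swap-at-q i≢-j))

  t-fix : ∀ x → j < ∣ x ∣ → t i j x ≡ x
  t-fix x j<∣x∣ = by-kind
    (λ i≡-j → trans (t-negate1or i≡-j) (negate1or-miss (hits1or-miss j x ∣x∣≢1 (∣x∣≢j ∘ sym))))
    (λ i≢-j → trans (t-swap i≢-j) (swap-fixes (∣∣≢⇒≢ ∣x∣≢∣i∣) (∣∣≢⇒≢ (∣x∣≢j ∘ sym)) (∣∣≢⇒≢- ∣x∣≢∣i∣) (∣∣≢⇒≢- (∣x∣≢j ∘ sym))))
    where
    ∣x∣≢j : j ≢ ∣ x ∣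
    ∣x∣≢j = ℕ.<⇒≢ j<∣x∣
    ∣x∣≢1 : ∣ x ∣ ≢ 1
    ∣x∣≢1 = ℕ.>⇒≢ (ℕ.≤-<-trans 1≤j j<∣x∣)
    ∣x∣≢∣i∣ : ∣ x ∣ ≢ ∣ i ∣
    ∣x∣≢∣i∣ = ℕ.>⇒≢ (ℕ.≤-<-trans (∈±⇒∣∣≤ i∈±j) j<∣x∣)

  t-moves-two : 2 ≤ j → i ≢ + j → MovesTwo (t i j) j
  t-moves-two 2≤j i≢j = by-kind negating swapping
    where
    negating : i ≡ - (+ j) → MovesTwo (t i j) j
    negating i≡-j = record
      { a = 1 ; 1≤a = ℕ.≤-refl ; a<j = 2≤j
      ; moves = inj₂ (inj₂ (negated (hits1or-at-1 j (+ 1) refl) , negated (hits1or-at-j j (+ j) refl)))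
      ; fixes = λ k _ k≢1 k≢j → trans (t-negate1or i≡-j) (negate1or-miss (hits1or-miss j (+ k) k≢1 k≢j)) }
      where
      negated : ∀ {x} → hits1or j x ≡ true → t i j x ≡ - x
      negated hit = trans (t-negate1or i≡-j) (negate1or-hit hit)
    swapping : i ≢ - (+ j) → MovesTwo (t i j) j
    swapping i≢-j = by-sign i∈±j refl
      where
      by-sign : ∀ {i′} → i′ ∈± j → i′ ≡ i → MovesTwo (t i j) j
      by-sign (+∈± {b} b<j) refl = record
        { a = suc b ; 1≤a = s≤s z≤n ; a<j = ℕ.≤∧≢⇒< b<j (i≢j ∘ cong (+_))
        ; moves = inj₁ (t-at-i , t-at-j)
        ; fixes = λ k _ k≢a k≢j → trans (t-swap i≢-j)
            (swap-fixes (k≢a ∘ ℤ.+-injective) (k≢j ∘ ℤ.+-injective) (λ ()) (+≢-+ k 1≤j)) }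
      by-sign (-∈± {b} b<j) refl = record
        { a = suc b ; 1≤a = s≤s z≤n ; a<j = ℕ.≤∧≢⇒< b<j (i≢-j ∘ cong (λ m → - (+ m)))
        ; moves = inj₂ (inj₁ (trans (t-odd i) (cong -_ t-at-i) , t-at-j))
        ; fixes = λ k _ k≢a k≢j → trans (t-swap i≢-j)
            (swap-fixes (λ ()) (k≢j ∘ ℤ.+-injective) (k≢a ∘ ℤ.+-injective) (+≢-+ k 1≤j)) }

-- Windows and the elements of D_n

map-range : ∀ {A : Set} (f : ℕ → A) n → map f (range n) ≡ applyUpTo (f ∘ suc) n
map-range f n = begin
  map f (map suc (applyUpTo (λ k → k) n)) ≡⟨ List.map-∘ _ ⟨
  map (f ∘ suc) (applyUpTo (λ k → k) n)   ≡⟨ List.map-applyUpTo _ (f ∘ suc) n ⟩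
  applyUpTo (f ∘ suc) n                   ∎
  where open ≡-Reasoning

nth-applyUpTo : ∀ (g : ℕ → ℤ) {n k} → k < n → nth (applyUpTo g n) (suc k) ≡ g k
nth-applyUpTo g {suc n} {zero} _ = refl
nth-applyUpTo g {suc n} {suc k} (s≤s k<n) = nth-applyUpTo (g ∘ suc) k<n

applyUpTo-nth : ∀ (w : List ℤ) → applyUpTo (nth w ∘ suc) (length w) ≡ w
applyUpTo-nth [] = refl
applyUpTo-nth (x ∷ xs) = cong (x ∷_) (applyUpTo-nth xs)

χ<0 : ℤ → ℕ
χ<0 (+ _) = 0
χ<0 -[1+ _ ] = 1

negCount≡sum-χ<0 : ∀ w → negCount w ≡ sum (map χ<0 w)
negCount≡sum-χ<0 [] = refl
negCount≡sum-χ<0 (+ _ ∷ w) = negCount≡sum-χ<0 w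
negCount≡sum-χ<0 (-[1+ _ ] ∷ w) = cong suc (negCount≡sum-χ<0 w)

module Window (n : ℕ) where

  window : (ℕ → ℤ) → List ℤ
  window f = map f (range n)

  length-window : ∀ f → length (window f) ≡ n
  length-window f = trans (List.length-map f (range n)) (trans (List.length-map suc (applyUpTo _ n)) (List.length-upTo n))

  nth-window : ∀ f {k} → 1 ≤ k → k ≤ n → nth (window f) k ≡ f k
  nth-window f {suc k} _ k<n = trans (cong (λ l → nth l (suc k)) (map-range f n)) (nth-applyUpTo (f ∘ suc) k<n)

  window-nth : ∀ {w} → length w ≡ n → window (nth w) ≡ w
  window-nth {w} refl = trans (map-range (nth w) (length w)) (applyUpTo-nth w)

  negCount-window : ∀ f → negCount (window f) ≡ sum (map (χ<0 ∘ f) (range n))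
  negCount-window f = trans (negCount≡sum-χ<0 (window f)) (cong sum (sym (List.map-∘ (range n))))

  window-cong : ∀ {f g} → (∀ {k} → 1 ≤ k → k ≤ n → f k ≡ g k) → window f ≡ window g
  window-cong f≡g = List.map-cong-local (All.tabulate λ k∈ → let 1≤k , k≤n = ∈-range⁻ k∈ in f≡g 1≤k k≤n)

apply-odd : ∀ w x → apply w (- x) ≡ - apply w x
apply-odd w (+ zero) = refl
apply-odd w (+ suc k) = refl
apply-odd w -[1+ k ] = sym (ℤ.neg-involutive _)

χ<0-both-negated : ∀ {n x y} → x ∈± n → y ∈± n → (χ<0 (- x) + χ<0 (- y)) + (χ<0 x + χ<0 y) ≡ 2
χ<0-both-negated (+∈± _) (+∈± _) = refl
χ<0-both-negated (+∈± _) (-∈± _) = refl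
χ<0-both-negated (-∈± _) (+∈± _) = refl
χ<0-both-negated (-∈± _) (-∈± _) = refl

χ<0-even⇒≡0 : ∀ x → 2 ∣ χ<0 x → χ<0 x ≡ 0
χ<0-even⇒≡0 (+ _) _ = refl
χ<0-even⇒≡0 -[1+ _ ] 2∣1 = contradiction (∣1⇒≡1 2∣1) λ ()

sum-χ<0-+ : ∀ ks → sum (map (λ k → χ<0 (+ k)) ks) ≡ 0
sum-χ<0-+ [] = refl
sum-χ<0-+ (k ∷ ks) = sum-χ<0-+ ks

∣∣≡1⇒χ<0≡0⇒≡1 : ∀ x → ∣ x ∣ ≡ 1 → χ<0 x ≡ 0 → x ≡ + 1
∣∣≡1⇒χ<0≡0⇒≡1 (+ _) refl _ = refl

moved-χ<0-even : ∀ {n x y x′ y′} → x ∈± n → y ∈± n → Moved x y x′ y′ → 2 ∣ (χ<0 x′ + χ<0 y′) + (χ<0 x + χ<0 y)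
moved-χ<0-even {x = x} {y} _ _ (inj₁ (refl , refl)) =
  subst (λ s → 2 ∣ s + (χ<0 x + χ<0 y)) (ℕ.+-comm (χ<0 x) (χ<0 y)) (subst (2 ∣_) (cong (λ z → m + z) (ℕ.+-identityʳ m)) (m∣m*n m))
  where m = χ<0 x + χ<0 y
moved-χ<0-even {x = x} {y} x∈ y∈ (inj₂ (inj₁ (refl , refl))) =
  subst (λ s → 2 ∣ (χ<0 (- y) + χ<0 (- x)) + s) (ℕ.+-comm (χ<0 y) (χ<0 x)) (∣-reflexive (sym (χ<0-both-negated y∈ x∈)))
moved-χ<0-even x∈ y∈ (inj₂ (inj₂ (refl , refl))) = ∣-reflexive (sym (χ<0-both-negated x∈ y∈))

record IsDn (n : ℕ) (w : List ℤ) : Set where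
  field
    length≡ : length w ≡ n
    apply-∈± : ∀ {x} → x ∈± n → apply w x ∈± n
    apply-injective : ∀ {x y} → x ∈± n → y ∈± n → apply w x ≡ apply w y → x ≡ y
    even-negatives : 2 ∣ negCount w

module RightMultiplication (n : ℕ) where

  open Window n

  even-negatives-moves-two : ∀ (f g : ℕ → ℤ) {a j} → a ∈ range n → j ∈ range n → a ≢ j →
    (∀ {k} → k ∈ range n → k ≢ a → k ≢ j → g k ≡ f k) →
    2 ∣ (χ<0 (g a) + χ<0 (g j)) + (χ<0 (f a) + χ<0 (f j)) →
    2 ∣ negCount (window f) → 2 ∣ negCount (window g)
  even-negatives-moves-two f g {a} {j} a∈ j∈ a≢j g≡f 2∣moved 2∣f =
    subst (2 ∣_) (sym (negCount-window g)) (∣m+n∣m⇒∣n (subst (2 ∣_) (sym balance) 2∣rhs) 2∣moved)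
    where
    open ≡-Reasoning
    Σ : (ℕ → ℤ) → ℕ
    Σ h = sum (map (χ<0 ∘ h) (range n))
    X = χ<0 (f a) + χ<0 (f j)
    Y = χ<0 (g a) + χ<0 (g j)
    balance : (Y + X) + Σ g ≡ Σ f + (Y + Y)
    balance = begin
      (Y + X) + Σ g ≡⟨ ℕ.+-comm (Y + X) (Σ g) ⟩
      Σ g + (Y + X) ≡⟨ cong (λ z → Σ g + z) (ℕ.+-comm Y X) ⟩
      Σ g + (X + Y) ≡⟨ ℕ.+-assoc (Σ g) X Y ⟨
      (Σ g + X) + Y ≡⟨ cong (_+ Y) (sum-map-update₂ ℕ._≟_ (Unique-range n) a∈ j∈ a≢j λ k∈ k≢a k≢j → cong χ<0 (g≡f k∈ k≢a k≢j)) ⟩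
      (Σ f + Y) + Y ≡⟨ ℕ.+-assoc (Σ f) Y Y ⟩
      Σ f + (Y + Y) ∎
    2∣rhs : 2 ∣ Σ f + (Y + Y)
    2∣rhs = ∣m∣n⇒∣m+n (subst (2 ∣_) (negCount-window f) 2∣f) (subst (2 ∣_) (cong (λ z → Y + z) (ℕ.+-identityʳ Y)) (m∣m*n Y))

  apply-window : ∀ w (τ : ℤ → ℤ) → (∀ x → τ (- x) ≡ - τ x) →
    ∀ {x} → x ∈± n → apply (window (λ k → apply w (τ (+ k)))) x ≡ apply w (τ x)
  apply-window w τ τ-odd (+∈± b<n) = nth-window _ (s≤s z≤n) b<n
  apply-window w τ τ-odd { -[1+ b ]} (-∈± b<n) = begin
    - nth (window (λ k → apply w (τ (+ k)))) (suc b) ≡⟨ cong -_ (nth-window _ (s≤s z≤n) b<n) ⟩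
    - apply w (τ (+ suc b))                         ≡⟨ apply-odd w (τ (+ suc b)) ⟨
    apply w (- τ (+ suc b))                         ≡⟨ cong (apply w) (τ-odd (+ suc b)) ⟨
    apply w (τ -[1+ b ])                            ∎
    where open ≡-Reasoning

  module _ {i j} (1≤j : 1 ≤ j) (i∈±j : i ∈± j) where
    open Generator 1≤j i∈±j

    apply-mulT : ∀ w {x} → x ∈± n → apply (mulT n w i j) x ≡ apply w (t i j x)
    apply-mulT w = apply-window w (t i j) t-odd

    mulT-involutive : ∀ {v} → length v ≡ n → j ≤ n → mulT n (mulT n v i j) i j ≡ v
    mulT-involutive {v} v-length j≤n = trans (window-cong same) (window-nth v-length)
      where
      same : ∀ {k} → 1 ≤ k → k ≤ n → apply (mulT n v i j) (t i j (+ k)) ≡ nth v k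
      same {k} 1≤k k≤n = trans (apply-mulT v (t-∈± j≤n (∈±-+ 1≤k k≤n))) (cong (apply v) (t-involutive (+ k)))

  mulT-self : ∀ {v j} → length v ≡ n → 1 ≤ j → mulT n v (+ j) j ≡ v
  mulT-self {v} {j} v-length 1≤j = trans (window-cong λ {k} _ _ → cong (apply v) (t-self j (+ k) 1≤j)) (window-nth v-length)

  mulT-IsDn : ∀ {v i j} → IsDn n v → 2 ≤ j → j ≤ n → i ∈± j → IsDn n (mulT n v i j)
  mulT-IsDn {v} {i} {j} v∈Dn 2≤j j≤n i∈±j = record
    { length≡ = length-window _
    ; apply-∈± = λ x∈± → subst (_∈± n) (sym (apply-mulT′ x∈±)) (apply-∈± (t-∈± j≤n x∈±))
    ; apply-injective = λ {x} {y} x∈± y∈± wx≡wy → begin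
        x               ≡⟨ t-involutive x ⟨
        t i j (t i j x) ≡⟨ cong (t i j) (apply-injective (t-∈± j≤n x∈±) (t-∈± j≤n y∈±)
                             (trans (sym (apply-mulT′ x∈±)) (trans wx≡wy (apply-mulT′ y∈±)))) ⟩
        t i j (t i j y) ≡⟨ t-involutive y ⟩
        y               ∎
    ; even-negatives = even (i ℤ.≟ + j) }
    where
    open ≡-Reasoning
    open IsDn v∈Dn
    1≤j : 1 ≤ j
    1≤j = ℕ.≤-trans (s≤s z≤n) 2≤j
    open Generator 1≤j i∈±j
    apply-mulT′ : ∀ {x} → x ∈± n → apply (mulT n v i j) x ≡ apply v (t i j x)
    apply-mulT′ = apply-mulT 1≤j i∈±j v
    even : Dec (i ≡ + j) → 2 ∣ negCount (mulT n v i j)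
    even (yes refl) = subst (λ w → 2 ∣ negCount w) (sym (mulT-self length≡ 1≤j)) even-negatives
    even (no i≢j) = even-negatives-moves-two (nth v) (λ k → apply v (t i j (+ k))) (∈-range⁺ 1≤a a≤n) (∈-range⁺ 1≤j j≤n)
      (ℕ.<⇒≢ a<j) (λ k∈ k≢a k≢j → cong (apply v) (fixes _ (proj₁ (∈-range⁻ k∈)) k≢a k≢j))
      (moved-χ<0-even (apply-∈± (∈±-+ 1≤a a≤n)) (apply-∈± (∈±-+ 1≤j j≤n)) (Moved-odd (apply v) (apply-odd v) moves))
      (subst (λ w → 2 ∣ negCount w) (sym (window-nth length≡)) even-negatives)
      where
      open MovesTwo (t-moves-two 2≤j i≢j)
      a≤n : a ≤ n
      a≤n = ℕ.≤-trans (ℕ.<⇒≤ a<j) j≤n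

elemℕ⇒∈ : ∀ {x} xs → T (elemℕ x xs) → x ∈ xs
elemℕ⇒∈ {x} (y ∷ ys) hit with x ℕ.≟ y
... | yes refl = here refl
... | no _ = there (elemℕ⇒∈ ys hit)

∈⇒elemℕ : ∀ {x xs} → x ∈ xs → T (elemℕ x xs)
∈⇒elemℕ {x} {y ∷ _} (here refl) with x ℕ.≟ x
... | yes _ = _
... | no x≢x = contradiction refl x≢x
∈⇒elemℕ {x} {y ∷ _} (there x∈) with x ℕ.≟ y
... | yes _ = _
... | no _ = ∈⇒elemℕ x∈

¬T-not : ∀ {b} → T (not b) → ¬ T b
¬T-not {false} _ ()

distinct⇒Unique : ∀ xs → T (distinct xs) → Unique xs
distinct⇒Unique [] _ = []
distinct⇒Unique (x ∷ xs) h with x∉ , rest ← Equivalence.to Bool.T-∧ h =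
  All.tabulate (λ y∈ x≡y → ¬T-not x∉ (∈⇒elemℕ (subst (_∈ xs) (sym x≡y) y∈))) ∷ distinct⇒Unique xs rest

Unique⇒distinct : ∀ {xs} → Unique xs → T (distinct xs)
Unique⇒distinct [] = _
Unique⇒distinct {x ∷ xs} (x∉ ∷ u) = Equivalence.from Bool.T-∧ (not-elem , Unique⇒distinct u)
  where
  not-elem : T (not (elemℕ x xs))
  not-elem with elemℕ x xs in e
  ... | false = _
  ... | true = contradiction refl (All.lookup x∉ (elemℕ⇒∈ xs (subst T (sym e) _)))

isEven⇒2∣ : ∀ k → T (isEven k) → 2 ∣ k
isEven⇒2∣ zero _ = 2 ∣0
isEven⇒2∣ (suc (suc k)) h = ∣m∣n⇒∣m+n ∣-refl (isEven⇒2∣ k h)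

2∣⇒isEven : ∀ k → 2 ∣ k → T (isEven k)
2∣⇒isEven zero _ = _
2∣⇒isEven (suc zero) 2∣1 = contradiction (∣1⇒≡1 2∣1) λ ()
2∣⇒isEven (suc (suc k)) 2∣k+2 = 2∣⇒isEven k (∣m+n∣m⇒∣n 2∣k+2 ∣-refl)

module DnMembership (n : ℕ) where

  open Window n
  open RightMultiplication n

  ∈-words⁺ : ∀ {m w} → length w ≡ m → All (_∈± n) w → w ∈ words n m
  ∈-words⁺ {zero} {[]} _ _ = here refl
  ∈-words⁺ {suc m} {x ∷ w} len (x∈± ∷ w∈±) =
    ∈-concatMap⁺ (λ y → map (y ∷_) (words n m)) (lose (∈-signedVals⁺ x∈±) (∈-map⁺ (x ∷_) (∈-words⁺ (ℕ.suc-injective len) w∈±)))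

  ∈-words⁻ : ∀ {m w} → w ∈ words n m → length w ≡ m × All (_∈± n) w
  ∈-words⁻ {zero} (here refl) = refl , []
  ∈-words⁻ {suc m} w∈
    with x , x∈ , w∈′ ← find (∈-concatMap⁻ (λ y → map (y ∷_) (words n m)) {xs = signedVals n} w∈)
    with w′ , w′∈ , refl ← ∈-map⁻ (x ∷_) w∈′
    = let len , w′∈± = ∈-words⁻ w′∈ in cong suc len , ∈-signedVals⁻ x∈ ∷ w′∈±

  All-window : ∀ {P : ℤ → Set} f → (∀ {k} → 1 ≤ k → k ≤ n → P (f k)) → All P (window f)
  All-window f Pf = All.map⁺ (All.tabulate λ k∈ → let 1≤k , k≤n = ∈-range⁻ k∈ in Pf 1≤k k≤n)

  ∣apply∣ : ∀ w {x} → x ∈± n → ∣ apply w x ∣ ≡ ∣ nth w ∣ x ∣ ∣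
  ∣apply∣ w (+∈± _) = refl
  ∣apply∣ w (-∈± {b} _) = ℤ.∣-i∣≡∣i∣ (nth w (suc b))

  map-∣∣-window : ∀ {w} → length w ≡ n → map ∣_∣ w ≡ map (∣_∣ ∘ nth w) (range n)
  map-∣∣-window len = trans (cong (map ∣_∣) (sym (window-nth len))) (sym (List.map-∘ (range n)))

  Unique-∣window∣ : ∀ {w} → IsDn n w → Unique (map (∣_∣ ∘ nth w) (range n))
  Unique-∣window∣ {w} w∈Dn = Unique-map⁺-local _ injective (Unique-range n)
    where
    open IsDn w∈Dn
    injective : ∀ {k k′} → k ∈ range n → k′ ∈ range n → ∣ nth w k ∣ ≡ ∣ nth w k′ ∣ → k ≡ k′
    injective {k} {k′} k∈ k′∈ e with 1≤k , k≤n ← ∈-range⁻ k∈ | 1≤k′ , k′≤n ← ∈-range⁻ k′∈ | ∣∣≡∣∣⇒≡⊎≡- e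
    ... | inj₁ same = ℤ.+-injective (apply-injective (∈±-+ 1≤k k≤n) (∈±-+ 1≤k′ k′≤n) same)
    ... | inj₂ opposite = contradiction
      (apply-injective (∈±-+ 1≤k k≤n) (∈±-neg (∈±-+ 1≤k′ k′≤n)) (trans opposite (sym (apply-odd w (+ k′)))))
      (+≢-+ k 1≤k′)

  IsDn⇒∈-Dn : ∀ {w} → IsDn n w → w ∈ Dn n
  IsDn⇒∈-Dn {w} w∈Dn = ∈-filter⁺ (Bool.T? ∘ isDn) (∈-words⁺ length≡ entries)
    (Equivalence.from Bool.T-∧ (Unique⇒distinct (subst Unique (sym (map-∣∣-window length≡)) (Unique-∣window∣ w∈Dn)) ,
                                2∣⇒isEven _ even-negatives))
    where
    open IsDn w∈Dn
    entries : All (_∈± n) w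
    entries = subst (All (_∈± n)) (window-nth length≡) (All-window (nth w) λ 1≤k k≤n → apply-∈± (∈±-+ 1≤k k≤n))

  ∈-Dn⇒IsDn : ∀ {w} → w ∈ Dn n → IsDn n w
  ∈-Dn⇒IsDn {w} w∈
    with w∈words , isDn-w ← ∈-filter⁻ (Bool.T? ∘ isDn) {xs = words n n} w∈
    with len , entries ← ∈-words⁻ w∈words
    with distinct-w , even-w ← Equivalence.to Bool.T-∧ isDn-w
    = record { length≡ = len ; apply-∈± = apply-∈± ; apply-injective = apply-injective ; even-negatives = isEven⇒2∣ _ even-w }
    where
    nth-∈± : ∀ {k} → 1 ≤ k → k ≤ n → nth w k ∈± n
    nth-∈± 1≤k k≤n = All.lookup entries (subst (_ ∈_) (window-nth len) (∈-map⁺ (nth w) (∈-range⁺ 1≤k k≤n)))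
    apply-∈± : ∀ {x} → x ∈± n → apply w x ∈± n
    apply-∈± (+∈± b<n) = nth-∈± (s≤s z≤n) b<n
    apply-∈± (-∈± b<n) = ∈±-neg (nth-∈± (s≤s z≤n) b<n)
    unique : Unique (map (∣_∣ ∘ nth w) (range n))
    unique = subst Unique (map-∣∣-window len) (distinct⇒Unique _ distinct-w)
    apply-injective : ∀ {x y} → x ∈± n → y ∈± n → apply w x ≡ apply w y → x ≡ y
    apply-injective {x} {y} x∈± y∈± wx≡wy with ∣∣≡∣∣⇒≡⊎≡- (Unique-map⇒injective _ unique
        (∈-range⁺ (∈±⇒1≤∣∣ x∈±) (∈±⇒∣∣≤ x∈±)) (∈-range⁺ (∈±⇒1≤∣∣ y∈±) (∈±⇒∣∣≤ y∈±))
        (trans (sym (∣apply∣ w x∈±)) (trans (cong ∣_∣ wx≡wy) (∣apply∣ w y∈±))))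
    ... | inj₁ x≡y = x≡y
    ... | inj₂ refl = contradiction (≡-neg⇒≡0 (trans (sym wx≡wy) (apply-odd w y))) (∈±⇒≢0 (apply-∈± y∈±))

  range⊆∣window∣ : ∀ {w} → IsDn n w → range n ⊆ map (∣_∣ ∘ nth w) (range n)
  range⊆∣window∣ {w} w∈Dn = ⊆-pigeonhole ℕ._≟_ (Unique-∣window∣ w∈Dn) values⊆ (ℕ.≤-reflexive (sym (List.length-map _ (range n))))
    where
    open IsDn w∈Dn
    values⊆ : map (∣_∣ ∘ nth w) (range n) ⊆ range n
    values⊆ v∈ with k , k∈ , refl ← ∈-map⁻ (∣_∣ ∘ nth w) v∈ =
      let 1≤k , k≤n = ∈-range⁻ k∈ ; wk∈± = apply-∈± (∈±-+ 1≤k k≤n) in ∈-range⁺ (∈±⇒1≤∣∣ wk∈±) (∈±⇒∣∣≤ wk∈±)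

  apply-surjective : ∀ {w} → IsDn n w → ∀ {y} → y ∈± n → ∃ λ x → x ∈± n × apply w x ≡ y
  apply-surjective {w} w∈Dn {y} y∈±
    with k , k∈ , ∣y∣≡ ← ∈-map⁻ (∣_∣ ∘ nth w) (range⊆∣window∣ w∈Dn (∈-range⁺ (∈±⇒1≤∣∣ y∈±) (∈±⇒∣∣≤ y∈±)))
    with 1≤k , k≤n ← ∈-range⁻ k∈
    with ∣∣≡∣∣⇒≡⊎≡- (sym ∣y∣≡)
  ... | inj₁ wk≡y = + k , ∈±-+ 1≤k k≤n , wk≡y
  ... | inj₂ wk≡-y = - (+ k) , ∈±-neg (∈±-+ 1≤k k≤n) ,
        trans (apply-odd w (+ k)) (trans (cong -_ wk≡-y) (ℤ.neg-involutive y))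

invFind-finds : ∀ w y xs → (∃ λ x → x ∈ xs × apply w x ≡ y) → invFind w y xs ∈ xs × apply w (invFind w y xs) ≡ y
invFind-finds w y (x ∷ xs) (z , z∈ , wz≡y) = by-test (apply w x ℤ.≟ y)
  where
  by-test : Dec (apply w x ≡ y) → invFind w y (x ∷ xs) ∈ x ∷ xs × apply w (invFind w y (x ∷ xs)) ≡ y
  by-test (yes wx≡y) rewrite if-true {x = x} {y = invFind w y xs} (==-true wx≡y) = here refl , wx≡y
  by-test (no wx≢y) rewrite if-false {x = x} {y = invFind w y xs} (==-false wx≢y) = later z∈
    where
    later : z ∈ x ∷ xs → invFind w y xs ∈ x ∷ xs × apply w (invFind w y xs) ≡ y
    later (here refl) = contradiction wz≡y wx≢y
    later (there z∈xs) = let found∈ , found = invFind-finds w y xs (z , z∈xs , wz≡y) in there found∈ , found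

inv-correct : ∀ {n w x y} → IsDn n w → x ∈± n → apply w x ≡ y → inv n w y ≡ x
inv-correct {n} {w} {x} {y} w∈Dn x∈± wx≡y =
  let found∈ , found = invFind-finds w y (signedVals n) (x , ∈-signedVals⁺ x∈± , wx≡y) in
  IsDn.apply-injective w∈Dn (∈-signedVals⁻ found∈) x∈± (trans found (sym wx≡y))

-- The factorization and the sorting index

module Factorization (n : ℕ) where

  open Window n
  open RightMultiplication n
  open DnMembership n

  identity : List ℤ
  identity = window (λ k → + k)

  FixesAbove : ℕ → List ℤ → Set
  FixesAbove j w = ∀ {x} → x ∈± n → j < ∣ x ∣ → apply w x ≡ x

  -- All products t_{i₂ 2} ⋯ t_{i_{m+1} (m+1)} with i_j ∈ ±[j]; the choice i_j = j (t_{jj} is the identity)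
  -- stands for the absence of a factor with this j.
  products : ℕ → List (List ℤ)
  products zero = [ identity ]
  products (suc m) = concatMap (λ i → map (λ v → mulT n v i (2 + m)) (products m)) (signedVals (2 + m))

  apply-identity : ∀ {x} → x ∈± n → apply identity x ≡ x
  apply-identity (+∈± b<n) = nth-window _ (s≤s z≤n) b<n
  apply-identity (-∈± b<n) = cong -_ (nth-window _ (s≤s z≤n) b<n)

  identity-IsDn : IsDn n identity
  identity-IsDn = record
    { length≡ = length-window _
    ; apply-∈± = λ x∈± → subst (_∈± n) (sym (apply-identity x∈±)) x∈±
    ; apply-injective = λ x∈± y∈± e → trans (sym (apply-identity x∈±)) (trans e (apply-identity y∈±))
    ; even-negatives = subst (2 ∣_) (sym (trans (negCount-window _) (sum-χ<0-+ (range n)))) (2 ∣0) }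

  products-IsDn : ∀ {m w} → suc m ≤ n → w ∈ products m → IsDn n w × FixesAbove (suc m) w
  products-IsDn {zero} _ (here refl) = identity-IsDn , λ x∈± _ → apply-identity x∈±
  products-IsDn {suc m} 2+m≤n w∈
    with i , i∈ , w∈′ ← find (∈-concatMap⁻ (λ i → map (λ v → mulT n v i (2 + m)) (products m)) {xs = signedVals (2 + m)} w∈)
    with v , v∈ , refl ← ∈-map⁻ (λ v → mulT n v i (2 + m)) w∈′
    with v∈Dn , v-fixes ← products-IsDn (ℕ.<⇒≤ 2+m≤n) v∈
    = mulT-IsDn v∈Dn (s≤s (s≤s z≤n)) 2+m≤n i∈± , fixes
    where
    i∈± : i ∈± 2 + m
    i∈± = ∈-signedVals⁻ i∈
    fixes : FixesAbove (2 + m) (mulT n v i (2 + m))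
    fixes {x} x∈± 2+m<∣x∣ = trans (apply-mulT (s≤s z≤n) i∈± v x∈±)
      (trans (cong (apply v) (Generator.t-fix (s≤s z≤n) i∈± x 2+m<∣x∣)) (v-fixes x∈± (ℕ.<-trans (ℕ.n<1+n _) 2+m<∣x∣)))

  -- An element of D_n fixing 2, …, n is the identity: injectivity forces w(1) = ±1, and w(1) = -1
  -- would leave exactly one negative entry.
  module _ {w} (w∈Dn : IsDn n w) (w-fixes : FixesAbove 1 w) where
    open IsDn w∈Dn

    ∣apply-1∣≡1 : 1 ≤ n → ∣ nth w 1 ∣ ≡ 1
    ∣apply-1∣≡1 1≤n = ℕ.≤-antisym (ℕ.≮⇒≥ not-above) (∈±⇒1≤∣∣ w1∈±)
      where
      1∈± : + 1 ∈± n
      1∈± = ∈±-+ ℕ.≤-refl 1≤n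
      w1∈± : nth w 1 ∈± n
      w1∈± = apply-∈± 1∈±
      not-above : ¬ 1 < ∣ nth w 1 ∣
      not-above 1<m = by-sign (∣∣≡∣∣⇒≡⊎≡- {nth w 1} {+ m} refl)
        where
        m = ∣ nth w 1 ∣
        m∈± : + m ∈± n
        m∈± = ∈±-+ (ℕ.<⇒≤ 1<m) (∈±⇒∣∣≤ w1∈±)
        wm≡m : apply w (+ m) ≡ + m
        wm≡m = w-fixes m∈± 1<m
        by-sign : nth w 1 ≡ + m ⊎ nth w 1 ≡ - (+ m) → ⊥
        by-sign (inj₁ w1≡m) = ℕ.<⇒≢ 1<m (ℤ.+-injective (apply-injective 1∈± m∈± (trans w1≡m (sym wm≡m))))
        by-sign (inj₂ w1≡-m) = +≢-+ 1 (ℕ.<⇒≤ 1<m)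
          (apply-injective 1∈± (∈±-neg m∈±) (trans w1≡-m (trans (cong -_ (sym wm≡m)) (sym (apply-odd w (+ m))))))

    χ<0-apply-1 : 1 ≤ n → χ<0 (nth w 1) ≡ 0
    χ<0-apply-1 1≤n = χ<0-even⇒≡0 (nth w 1) (subst (2 ∣_) count even-negatives)
      where
      open ≡-Reasoning
      Σw = sum (map (χ<0 ∘ nth w) (range n))
      count : negCount w ≡ χ<0 (nth w 1)
      count = begin
        negCount w                                       ≡⟨ cong negCount (window-nth length≡) ⟨
        negCount (window (nth w))                        ≡⟨ negCount-window (nth w) ⟩
        Σw                                               ≡⟨ ℕ.+-identityʳ Σw ⟨
        Σw + χ<0 (+ 1)                                   ≡⟨ sum-map-update (Unique-range n) (∈-range⁺ ℕ.≤-refl 1≤n) fixed ⟩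
        sum (map (λ k → χ<0 (+ k)) (range n)) + χ<0 (nth w 1) ≡⟨ cong (_+ χ<0 (nth w 1)) (sum-χ<0-+ (range n)) ⟩
        χ<0 (nth w 1)                                    ∎
        where
        fixed : ∀ {k} → k ∈ range n → k ≢ 1 → χ<0 (nth w k) ≡ χ<0 (+ k)
        fixed k∈ k≢1 = let 1≤k , k≤n = ∈-range⁻ k∈ in
          cong χ<0 (w-fixes (∈±-+ 1≤k k≤n) (ℕ.≤∧≢⇒< 1≤k (k≢1 ∘ sym)))

    fixes-above-1⇒identity : 1 ≤ n → w ≡ identity
    fixes-above-1⇒identity 1≤n = trans (sym (window-nth length≡)) (window-cong at)
      where
      at : ∀ {k} → 1 ≤ k → k ≤ n → nth w k ≡ + k
      at {suc zero} _ _ = ∣∣≡1⇒χ<0≡0⇒≡1 (nth w 1) (∣apply-1∣≡1 1≤n) (χ<0-apply-1 1≤n)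
      at {suc (suc k)} _ k≤n = w-fixes (∈±-+ (s≤s z≤n) k≤n) (s≤s (s≤s z≤n))

  preimage-j : ∀ {m w} → 2 + m ≤ n → IsDn n w → FixesAbove (2 + m) w → ∃ λ x → x ∈± 2 + m × apply w x ≡ + (2 + m)
  preimage-j {m} {w} 2+m≤n w∈Dn w-fixes with x , x∈±n , wx≡j ← apply-surjective w∈Dn (∈±-+ (s≤s z≤n) 2+m≤n) with ∣ x ∣ ℕ.≤? 2 + m
  ... | yes ∣x∣≤j = x , ∈±-∣∣ x (∈±⇒1≤∣∣ x∈±n) ∣x∣≤j , wx≡j
  ... | no ∣x∣≰j = contradiction (cong ∣_∣ (trans (sym (w-fixes x∈±n j<∣x∣)) wx≡j)) (ℕ.>⇒≢ j<∣x∣)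
    where
    j<∣x∣ = ℕ.≰⇒> ∣x∣≰j

  module Peel {m w x} (2+m≤n : 2 + m ≤ n) (w∈Dn : IsDn n w) (w-fixes : FixesAbove (2 + m) w)
              (x∈± : x ∈± 2 + m) (wx≡j : apply w x ≡ + (2 + m)) where
    open IsDn w∈Dn
    private
      j = 2 + m
      1≤j : 1 ≤ j
      1≤j = s≤s z≤n
      open Generator 1≤j x∈±

    peel-IsDn : IsDn n (mulT n w x j)
    peel-IsDn = mulT-IsDn w∈Dn (s≤s (s≤s z≤n)) 2+m≤n x∈±

    peel-fixes : FixesAbove (suc m) (mulT n w x j)
    peel-fixes {y} y∈± 1+m<∣y∣ with j ℕ.<? ∣ y ∣
    ... | yes j<∣y∣ = trans (apply-mulT 1≤j x∈± w y∈±) (trans (cong (apply w) (t-fix y j<∣y∣)) (w-fixes y∈± j<∣y∣))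
    ... | no j≮∣y∣ with ∣∣≡∣∣⇒≡⊎≡- {y} {+ j} (ℕ.≤-antisym (ℕ.≮⇒≥ j≮∣y∣) 1+m<∣y∣)
    ...   | inj₁ refl = trans (apply-mulT 1≤j x∈± w y∈±) (trans (cong (apply w) t-at-j) wx≡j)
    ...   | inj₂ refl = trans (apply-mulT 1≤j x∈± w y∈±)
                          (trans (cong (apply w) (trans (t-odd (+ j)) (cong -_ t-at-j))) (trans (apply-odd w x) (cong -_ wx≡j)))

    peel-undo : mulT n (mulT n w x j) x j ≡ w
    peel-undo = mulT-involutive 1≤j x∈± length≡ 2+m≤n

  IsDn⇒∈-products : ∀ m {w} → suc m ≤ n → IsDn n w → FixesAbove (suc m) w → w ∈ products m
  IsDn⇒∈-products zero 1≤n w∈Dn w-fixes = here (fixes-above-1⇒identity w∈Dn w-fixes 1≤n)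
  IsDn⇒∈-products (suc m) 2+m≤n w∈Dn w-fixes with x , x∈± , wx≡j ← preimage-j 2+m≤n w∈Dn w-fixes =
    ∈-concatMap⁺ (λ i → map (λ v → mulT n v i (2 + m)) (products m))
      (lose (∈-signedVals⁺ x∈±) (subst (_∈ map (λ v → mulT n v x (2 + m)) (products m)) peel-undo
        (∈-map⁺ (λ v → mulT n v x (2 + m)) (IsDn⇒∈-products m (ℕ.<⇒≤ 2+m≤n) peel-IsDn peel-fixes))))
    where open Peel 2+m≤n w∈Dn w-fixes x∈± wx≡j

  module _ {m v i} (2+m≤n : 2 + m ≤ n) (v∈ : v ∈ products m) (i∈± : i ∈± 2 + m) where
    private
      j = 2 + m
      1≤j : 1 ≤ j
      1≤j = s≤s z≤n
      v∈Dn = proj₁ (products-IsDn (ℕ.<⇒≤ 2+m≤n) v∈)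
      v-fixes = proj₂ (products-IsDn (ℕ.<⇒≤ 2+m≤n) v∈)

    product-IsDn : IsDn n (mulT n v i j)
    product-IsDn = mulT-IsDn v∈Dn (s≤s (s≤s z≤n)) 2+m≤n i∈±

    inv-product : inv n (mulT n v i j) (+ j) ≡ i
    inv-product = inv-correct product-IsDn (∈±-mono 2+m≤n i∈±)
      (trans (apply-mulT 1≤j i∈± v (∈±-mono 2+m≤n i∈±))
        (trans (cong (apply v) (Generator.t-at-i 1≤j i∈±)) (v-fixes (∈±-+ 1≤j 2+m≤n) ℕ.≤-refl)))

    product-undo : mulT n (mulT n v i j) i j ≡ v
    product-undo = mulT-involutive 1≤j i∈± (IsDn.length≡ v∈Dn) 2+m≤n

  Unique-products : ∀ m → suc m ≤ n → Unique (products m)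
  Unique-products zero _ = All.[] ∷ []
  Unique-products (suc m) 2+m≤n = Unique-concatMap⁺ _ (Unique-signedVals (2 + m))
    (λ {i} i∈ → Unique-map⁺-local _ (λ v∈ v′∈ e → trans (sym (product-undo 2+m≤n v∈ (∈-signedVals⁻ i∈)))
                                                 (trans (cong (λ z → mulT n z i (2 + m)) e) (product-undo 2+m≤n v′∈ (∈-signedVals⁻ i∈))))
                                 (Unique-products m (ℕ.<⇒≤ 2+m≤n)))
    disjoint
    where
    disjoint : ∀ {i i′ z} → i ∈ signedVals (2 + m) → i′ ∈ signedVals (2 + m) →
      z ∈ map (λ v → mulT n v i (2 + m)) (products m) → z ∈ map (λ v → mulT n v i′ (2 + m)) (products m) → i ≡ i′
    disjoint {i} {i′} i∈ i′∈ z∈ z∈′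
      with v , v∈ , refl ← ∈-map⁻ (λ v → mulT n v i (2 + m)) z∈
      with v′ , v′∈ , z≡ ← ∈-map⁻ (λ v → mulT n v i′ (2 + m)) z∈′
      = trans (sym (inv-product 2+m≤n v∈ (∈-signedVals⁻ i∈)))
          (trans (cong (λ z → inv n z (+ (2 + m))) z≡) (inv-product 2+m≤n v′∈ (∈-signedVals⁻ i′∈)))

  sorUpTo : ℕ → List ℤ → ℕ
  sorUpTo k w = sum (map weight (factorsAux n k w))

  sorUpTo-product : ∀ {m v i} → 2 + m ≤ n → v ∈ products m → i ∈± 2 + m →
    sorUpTo (2 + m) (mulT n v i (2 + m)) ≡ sorUpTo (suc m) v + weight (i , 2 + m)
  -- [factorsAux] recovers the last factor t_{i j} of the product as i = w⁻¹(j), by [inv-product].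
  sorUpTo-product {m} {v} {i} 2+m≤n v∈ i∈± =
    trans (cong (sum ∘ map weight ∘ factors-after) (inv-product 2+m≤n v∈ i∈±)) (by-cases (i ℤ.≟ + j))
    where
    j = 2 + m
    w = mulT n v i j
    factors-after : ℤ → List (ℤ × ℕ)
    factors-after i′ = if i′ == + j then factorsAux n (suc m) w else factorsAux n (suc m) (mulT n w i′ j) ++ [ (i′ , j) ]
    by-cases : Dec (i ≡ + j) → sum (map weight (factors-after i)) ≡ sorUpTo (suc m) v + weight (i , j)
    by-cases (yes refl) = begin
      sum (map weight (factors-after (+ j)))  ≡⟨ cong (sum ∘ map weight) (if-true (==-true {+ j} refl)) ⟩
      sorUpTo (suc m) w                       ≡⟨ cong (sorUpTo (suc m)) (mulT-self (IsDn.length≡ (proj₁ (products-IsDn (ℕ.<⇒≤ 2+m≤n) v∈))) (s≤s z≤n)) ⟩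
      sorUpTo (suc m) v                       ≡⟨ ℕ.+-identityʳ _ ⟨
      sorUpTo (suc m) v + 0                   ≡⟨ cong (λ z → sorUpTo (suc m) v + z) (ℕ.n∸n≡0 j) ⟨
      sorUpTo (suc m) v + weight (+ j , j)    ∎
      where open ≡-Reasoning
    by-cases (no i≢j) = begin
      sum (map weight (factors-after i))                                  ≡⟨ cong (sum ∘ map weight) (if-false {x = factorsAux n (suc m) w} (==-false i≢j)) ⟩
      sum (map weight (factorsAux n (suc m) (mulT n w i j) ++ [ (i , j) ])) ≡⟨ cong (λ u → sum (map weight (factorsAux n (suc m) u ++ [ (i , j) ]))) (product-undo 2+m≤n v∈ i∈±) ⟩
      sum (map weight (factorsAux n (suc m) v ++ [ (i , j) ]))            ≡⟨ cong sum (List.map-++ weight (factorsAux n (suc m) v) _) ⟩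
      sum (map weight (factorsAux n (suc m) v) ++ [ weight (i , j) ])     ≡⟨ sum-++ (map weight (factorsAux n (suc m) v)) _ ⟩
      sorUpTo (suc m) v + (weight (i , j) + 0)                            ≡⟨ cong (λ z → sorUpTo (suc m) v + z) (ℕ.+-identityʳ _) ⟩
      sorUpTo (suc m) v + weight (i , j)                                  ∎
      where open ≡-Reasoning

-- q-integers

module QIntegers (q : ℕ) where

  open ≡-Reasoning

  [_]q : ℕ → ℕ
  [ k ]q = qint k q

  qint≡sum-applyUpTo : ∀ k → [ k ]q ≡ sum (applyUpTo (q ^_) k)
  qint≡sum-applyUpTo k = cong sum (List.map-upTo (q ^_) k)

  qint-suc : ∀ k → [ suc k ]q ≡ [ k ]q + q ^ k
  qint-suc k = begin
    [ suc k ]q                                  ≡⟨ qint≡sum-applyUpTo (suc k) ⟩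
    sum (applyUpTo (q ^_) (suc k))              ≡⟨ cong sum (List.applyUpTo-∷ʳ (q ^_) k) ⟨
    sum (applyUpTo (q ^_) k ++ [ q ^ k ])       ≡⟨ sum-++ (applyUpTo (q ^_) k) _ ⟩
    sum (applyUpTo (q ^_) k) + (q ^ k + 0)      ≡⟨ cong₂ _+_ (qint≡sum-applyUpTo k) (sym (ℕ.+-identityʳ _)) ⟨
    [ k ]q + q ^ k                              ∎

  qint-+ : ∀ a b → [ a + b ]q ≡ [ a ]q + q ^ a * [ b ]q
  qint-+ a zero = begin
    [ a + 0 ]q            ≡⟨ cong [_]q (ℕ.+-identityʳ a) ⟩
    [ a ]q                ≡⟨ ℕ.+-identityʳ _ ⟨
    [ a ]q + 0            ≡⟨ cong (λ z → [ a ]q + z) (ℕ.*-zeroʳ (q ^ a)) ⟨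
    [ a ]q + q ^ a * 0    ∎
  qint-+ a (suc b) = begin
    [ a + suc b ]q                            ≡⟨ cong [_]q (ℕ.+-suc a b) ⟩
    [ suc (a + b) ]q                          ≡⟨ qint-suc (a + b) ⟩
    [ a + b ]q + q ^ (a + b)                  ≡⟨ cong₂ _+_ (qint-+ a b) (ℕ.^-distribˡ-+-* q a b) ⟩
    ([ a ]q + q ^ a * [ b ]q) + q ^ a * q ^ b ≡⟨ ℕ.+-assoc [ a ]q _ _ ⟩
    [ a ]q + (q ^ a * [ b ]q + q ^ a * q ^ b) ≡⟨ cong (λ z → [ a ]q + z) (ℕ.*-distribˡ-+ (q ^ a) _ _) ⟨
    [ a ]q + q ^ a * ([ b ]q + q ^ b)         ≡⟨ cong (λ z → [ a ]q + q ^ a * z) (qint-suc b) ⟨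
    [ a ]q + q ^ a * [ suc b ]q               ∎

  qint-double : ∀ i → [ 2 * i ]q ≡ (1 + q ^ i) * [ i ]q
  qint-double i = begin
    [ i + (i + 0) ]q         ≡⟨ cong (λ z → [ i + z ]q) (ℕ.+-identityʳ i) ⟩
    [ i + i ]q               ≡⟨ qint-+ i i ⟩
    [ i ]q + q ^ i * [ i ]q  ≡⟨⟩
    (1 + q ^ i) * [ i ]q     ∎

  sum-q^-reversed : ∀ k → sum (applyUpTo (λ b → q ^ (k ∸ b)) (suc k)) ≡ [ suc k ]q
  sum-q^-reversed zero = refl
  sum-q^-reversed (suc k) = begin
    q ^ suc k + sum (applyUpTo (λ b → q ^ (k ∸ b)) (suc k)) ≡⟨ cong (λ z → q ^ suc k + z) (sum-q^-reversed k) ⟩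
    q ^ suc k + [ suc k ]q                                 ≡⟨ ℕ.+-comm (q ^ suc k) _ ⟩
    [ suc k ]q + q ^ suc k                                 ≡⟨ qint-suc (suc k) ⟨
    [ suc (suc k) ]q                                       ∎

  weight-sum : ∀ k → sum (map (λ i → q ^ weight (i , suc k)) (signedVals (suc k))) ≡ (1 + q ^ k) * [ suc k ]q
  weight-sum k = begin
    sum (map W (positive ++ negative))        ≡⟨ cong sum (List.map-++ W positive negative) ⟩
    sum (map W positive ++ map W negative)    ≡⟨ sum-++ (map W positive) _ ⟩
    sum (map W positive) + sum (map W negative) ≡⟨ cong₂ _+_ positive-sum negative-sum ⟩
    [ suc k ]q + q ^ k * [ suc k ]q           ≡⟨⟩
    (1 + q ^ k) * [ suc k ]q                  ∎
    where
    W : ℤ → ℕ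
    W i = q ^ weight (i , suc k)
    positive = map (λ a → + a) (range (suc k))
    negative = map (λ a → - (+ a)) (range (suc k))
    positive-sum : sum (map W positive) ≡ [ suc k ]q
    positive-sum = trans (cong sum (trans (sym (List.map-∘ (range (suc k)))) (map-range (λ a → W (+ a)) (suc k)))) (sum-q^-reversed k)
    negative-sum : sum (map W negative) ≡ q ^ k * [ suc k ]q
    negative-sum = begin
      sum (map W negative)                                             ≡⟨ cong sum (trans (sym (List.map-∘ (range (suc k)))) (sym (List.map-∘ (upTo (suc k))))) ⟩
      sum (map (λ b → q ^ weight (ℤ.-[1+ b ] , suc k)) (upTo (suc k)))  ≡⟨ sum-map-cong (upTo (suc k)) (λ {b} _ → trans (cong (λ e → q ^ (e ∸ 1)) (ℕ.+-suc k b)) (ℕ.^-distribˡ-+-* q k b)) ⟩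
      sum (map (λ b → q ^ k * q ^ b) (upTo (suc k)))                   ≡⟨ sum-map-*ˡ (q ^ k) (q ^_) (upTo (suc k)) ⟩
      q ^ k * [ suc k ]q                                               ∎

product-range-suc : ∀ (f : ℕ → ℕ) m → product (map f (range (suc m))) ≡ product (map f (range m)) * f (suc m)
product-range-suc f m = begin
  product (map f (map suc (upTo (suc m))))            ≡⟨ cong (λ ks → product (map f (map suc ks))) (List.upTo-∷ʳ m) ⟨
  product (map f (map suc (upTo m ++ [ m ])))         ≡⟨ cong (product ∘ map f) (List.map-++ suc (upTo m) [ m ]) ⟩
  product (map f (range m ++ [ suc m ]))              ≡⟨ cong product (List.map-++ f (range m) [ suc m ]) ⟩
  product (map f (range m) ++ [ f (suc m) ])          ≡⟨ product-++ (map f (range m)) _ ⟩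
  product (map f (range m)) * (f (suc m) * 1)         ≡⟨ cong (λ z → product (map f (range m)) * z) (ℕ.*-identityʳ _) ⟩
  product (map f (range m)) * f (suc m)               ∎
  where open ≡-Reasoning

module QProducts (q : ℕ) where

  open QIntegers q
  open ≡-Reasoning
  open +-*-Solver using (solve; _:+_; _:*_; _:=_; con)

  factor : ℕ → ℕ
  factor i = (1 + q ^ i) * [ suc i ]q

  product-factor : ∀ m → product (map factor (range m)) ≡ [ suc m ]q * product (map (λ i → [ 2 * i ]q) (range m))
  product-factor zero = refl
  product-factor (suc m) = begin
    product (map factor (range (suc m)))                   ≡⟨ product-range-suc factor m ⟩
    product (map factor (range m)) * factor (suc m)        ≡⟨ cong (_* factor (suc m)) (product-factor m) ⟩
    ([ suc m ]q * P) * ((1 + q ^ suc m) * [ suc (suc m) ]q) ≡⟨ rearrange [ suc m ]q P (q ^ suc m) [ suc (suc m) ]q ⟩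
    [ suc (suc m) ]q * (P * ((1 + q ^ suc m) * [ suc m ]q)) ≡⟨ cong (λ z → [ suc (suc m) ]q * (P * z)) (qint-double (suc m)) ⟨
    [ suc (suc m) ]q * (P * [ 2 * suc m ]q)                 ≡⟨ cong (λ z → [ suc (suc m) ]q * z) (product-range-suc (λ i → [ 2 * i ]q) m) ⟨
    [ suc (suc m) ]q * product (map (λ i → [ 2 * i ]q) (range (suc m))) ∎
    where
    P = product (map (λ i → [ 2 * i ]q) (range m))
    rearrange : ∀ a p x b → (a * p) * ((1 + x) * b) ≡ b * (p * ((1 + x) * a))
    rearrange = solve 4 (λ a p x b → (a :* p) :* ((con 1 :+ x) :* b) := b :* (p :* ((con 1 :+ x) :* a))) refl

-- The generating function

Unique-words : ∀ n m → Unique (words n m)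
Unique-words n zero = All.[] ∷ []
Unique-words n (suc m) = Unique-concatMap⁺ (λ x → map (x ∷_) (words n m)) (Unique-signedVals n)
  (λ _ → Unique.map⁺ List.∷-injectiveʳ (Unique-words n m))
  λ {x} {x′} _ _ z∈ z∈′ → let _ , _ , z≡ = ∈-map⁻ (x ∷_) z∈ ; _ , _ , z≡′ = ∈-map⁻ (x′ ∷_) z∈′ in
    List.∷-injectiveˡ (trans (sym z≡) z≡′)

module _ (n : ℕ) where

  open Factorization n
  open DnMembership n

  Dn↭products : ∀ {m} → suc m ≡ n → Dn n ↭ products m
  Dn↭products {m} refl = Unique-⊆-↭ (Unique.filter⁺ (Bool.T? ∘ isDn) (Unique-words n n)) (Unique-products m ℕ.≤-refl)
    (λ w∈ → IsDn⇒∈-products m ℕ.≤-refl (∈-Dn⇒IsDn w∈) λ x∈± n<∣x∣ → contradiction (∈±⇒∣∣≤ x∈±) (ℕ.<⇒≱ n<∣x∣))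
    (λ w∈ → IsDn⇒∈-Dn (proj₁ (products-IsDn ℕ.≤-refl w∈)))

  module _ (q : ℕ) where
    open QIntegers q
    open QProducts q

    sum-q^sorUpTo-products : ∀ m → suc m ≤ n → sum (map (λ w → q ^ sorUpTo (suc m) w) (products m)) ≡ product (map factor (range m))
    sum-q^sorUpTo-products zero _ = refl
    sum-q^sorUpTo-products (suc m) 2+m≤n = begin
      sum (map (λ w → q ^ sorUpTo j w) (concatMap (λ i → map (λ v → mulT n v i j) (products m)) (signedVals j)))
        ≡⟨ sum-concatMap (λ w → q ^ sorUpTo j w) (λ i → map (λ v → mulT n v i j) (products m)) (signedVals j) ⟩
      sum (map (λ i → sum (map (λ w → q ^ sorUpTo j w) (map (λ v → mulT n v i j) (products m)))) (signedVals j))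
        ≡⟨ sum-map-cong (signedVals j) (λ i∈ → by-last-factor (∈-signedVals⁻ i∈)) ⟩
      sum (map (λ i → q ^ weight (i , j) * G) (signedVals j))
        ≡⟨ sum-map-*ʳ G (λ i → q ^ weight (i , j)) (signedVals j) ⟩
      sum (map (λ i → q ^ weight (i , j)) (signedVals j)) * G
        ≡⟨ cong₂ _*_ (weight-sum (suc m)) (sum-q^sorUpTo-products m (ℕ.<⇒≤ 2+m≤n)) ⟩
      factor (suc m) * product (map factor (range m))
        ≡⟨ ℕ.*-comm (factor (suc m)) _ ⟩
      product (map factor (range m)) * factor (suc m)
        ≡⟨ product-range-suc factor m ⟨
      product (map factor (range (suc m))) ∎
      where
      open ≡-Reasoning
      j = 2 + m
      G = sum (map (λ v → q ^ sorUpTo (suc m) v) (products m))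
      by-last-factor : ∀ {i} → i ∈± j → sum (map (λ w → q ^ sorUpTo j w) (map (λ v → mulT n v i j) (products m))) ≡ q ^ weight (i , j) * G
      by-last-factor {i} i∈± = begin
        sum (map (λ w → q ^ sorUpTo j w) (map (λ v → mulT n v i j) (products m)))  ≡⟨ cong sum (List.map-∘ (products m)) ⟨
        sum (map (λ v → q ^ sorUpTo j (mulT n v i j)) (products m))          ≡⟨ sum-map-cong (products m) (λ {v} v∈ → begin
            q ^ sorUpTo j (mulT n v i j)              ≡⟨ cong (q ^_) (sorUpTo-product 2+m≤n v∈ i∈±) ⟩
            q ^ (sorUpTo (suc m) v + weight (i , j))  ≡⟨ ℕ.^-distribˡ-+-* q (sorUpTo (suc m) v) (weight (i , j)) ⟩
            q ^ sorUpTo (suc m) v * q ^ weight (i , j) ≡⟨ ℕ.*-comm (q ^ sorUpTo (suc m) v) _ ⟩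
            q ^ weight (i , j) * q ^ sorUpTo (suc m) v ∎) ⟩
        sum (map (λ v → q ^ weight (i , j) * q ^ sorUpTo (suc m) v) (products m)) ≡⟨ sum-map-*ˡ (q ^ weight (i , j)) _ (products m) ⟩
        q ^ weight (i , j) * G ∎

sorGF≡prod1 : ∀ m q → sorGF (suc m) q ≡ prod1 (suc m) q
sorGF≡prod1 m q = trans (sum-↭ (Perm.map⁺ (λ w → q ^ sorD (suc m) w) (Dn↭products (suc m) refl)))
                        (sum-q^sorUpTo-products (suc m) q m ℕ.≤-refl)

prod1≡prod2 : ∀ m q → prod1 (suc m) q ≡ prod2 (suc m) q
prod1≡prod2 m q = QProducts.product-factor q m

-- Both identities hold for every n ≥ 1; the hypothesis 4 ≤ n is only used to exclude n = 0,
-- where [n]_q = 0.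
corollary4p4 : (n : ℕ) → 4 ≤ n → (q : ℕ) →
    (sorGF n q ≡ prod1 n q) × (sorGF n q ≡ prod2 n q)
corollary4p4 (suc m) _ q = sorGF≡prod1 m q , trans (sorGF≡prod1 m q) (prod1≡prod2 m q)
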